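{- For every non-negative integer $n$, $$(-64)^n\sum_{k=0}^n\left(\frac{(1/4)_k(3/4)_{n-k}}{(1)_k(1)_{n-k}}\right)^2=\sum_{k=0}^n\binom{4k}{2k}\binom{2k}{k}^2\binom{n+k}{n-k}(-64)^{n-k}.$$
   Context: $(\alpha)_n=\alpha(\alpha+1)\cdots(\alpha+n-1)$ denotes the Pochhammer symbol, with $(\alpha)_0=1$. -}

module Defs where

open import Data.Nat as ℕ using (ℕ; zero; suc)
open import Data.Integer as ℤ using (ℤ)
open import Data.Rational as ℚ using (ℚ; _+_; _*_; _÷_; 0ℚ; 1ℚ)
open import Data.Rational.Properties using (_≟_)
open import Relation.Nullary using (yes; no)
open import Relation.Nullary.Negation using (contradiction)

poch : ℚ → ℕ → ℚ
poch a zero    = 1ℚ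
poch a (suc n) = poch a n * (a + ((ℤ.+ n) ℚ./ 1))

-- Total division on ℚ (x / 0 := 0); only ever applied to nonzero divisors here.
_/'_ : ℚ → ℚ → ℚ
x /' y with y ≟ 0ℚ
... | yes _ = 0ℚ
... | no y≢0 = _÷_ x y {{ℚ.≢-nonZero y≢0}}

sumTo : ℕ → (ℕ → ℚ) → ℚ
sumTo zero    f = f 0
sumTo (suc n) f = sumTo n f + f (suc n)

sumToℤ : ℕ → (ℕ → ℤ) → ℤ
sumToℤ zero    f = f 0
sumToℤ (suc n) f = sumToℤ n f ℤ.+ f (suc n)

module Submission where

-- Multiplying by (n!)² turns both sides into integer sums: using 4ᵏ (r/4)ₖ = ∏_{i<k} (4i + r),
--   A(n) = Σₖ (-4)ⁿ (C(n,k) ∏_{i<k}(4i+1) ∏_{i<n-k}(4i+3))²   equals (n!)² times the left side, and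
--   B(n) = Σₖ C(4k,2k) C(2k,k)² C(n+k,2k) (-64)ⁿ⁻ᵏ              is the right side.
-- Creative telescoping, with certificates found by Zeilberger's algorithm, gives the recurrences
--   4096 (n+1)⁵ A(n) + 8 (2n+3)(8n²+24n+21) A(n+1) + (n+2)  A(n+2) = 0,
--   4096 (n+1)³ B(n) + 8 (2n+3)(8n²+24n+21) B(n+1) + (n+2)³ B(n+2) = 0.
-- The second one says that (n!)² B(n) satisfies the first, and A, (n!)² B both start with 1, -40.

module IntegerSequences where

  open import Data.Nat as ℕ using (ℕ; zero; suc; z≤n; s≤s)
  import Data.Nat.Properties as ℕₚ
  open import Data.Nat.Divisibility using (_∣_; divides; _∣?_)
  open import Data.Integer as ℤ using (ℤ; +_; -_; _+_; _-_; _*_; 0ℤ)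
  import Data.Integer.Properties as ℤₚ
  open import Data.Integer.Tactic.RingSolver using (solve-∀)
  open import Data.Sum using (inj₁; inj₂)
  open import Data.Product using (_×_; _,_; proj₁)
  open import Relation.Nullary using (¬_; yes; no)
  open import Relation.Nullary.Decidable using (from-no)
  open import Relation.Binary.PropositionalEquality
  open import Defs using (sumToℤ)

  *-≢0 : ∀ {i j} → i ≢ 0ℤ → j ≢ 0ℤ → i * j ≢ 0ℤ
  *-≢0 {i} i≢0 j≢0 ij≡0 with ℤₚ.i*j≡0⇒i≡0∨j≡0 i ij≡0
  ... | inj₁ i≡0 = i≢0 i≡0
  ... | inj₂ j≡0 = j≢0 j≡0

  sq-≢0 : ∀ i → i ≢ 0ℤ → i * i ≢ 0ℤ
  sq-≢0 i i≢0 = *-≢0 i≢0 i≢0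

  *-cancelʳ : ∀ {i j} k → k ≢ 0ℤ → i * k ≡ j * k → i ≡ j
  *-cancelʳ {i} {j} k k≢0 = ℤₚ.*-cancelʳ-≡ i j k {{ℤ.≢-nonZero k≢0}}

  i*j≡0⇒j≡0 : ∀ {i j} → i ≢ 0ℤ → i * j ≡ 0ℤ → j ≡ 0ℤ
  i*j≡0⇒j≡0 {i} {j} i≢0 ij≡0 = *-cancelʳ i i≢0 (trans (ℤₚ.*-comm j i) (trans ij≡0 (sym (ℤₚ.*-zeroˡ i))))

  products-vanish : ∀ {i j k l} → i ≡ 0ℤ → k ≡ 0ℤ → i * j ≡ k * l
  products-vanish {j = j} {l = l} refl refl = trans (ℤₚ.*-zeroˡ j) (sym (ℤₚ.*-zeroˡ l))

  products-vanish′ : ∀ {i j k l} → i ≡ 0ℤ → l ≡ 0ℤ → i * j ≡ k * l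
  products-vanish′ {j = j} {k = k} refl refl = trans (ℤₚ.*-zeroˡ j) (sym (ℤₚ.*-zeroʳ k))

  r+4x≢0 : ∀ x {r} → ¬ (4 ∣ r) → + r + + 4 * x ≢ 0ℤ
  r+4x≢0 x {r} 4∤r r+4x≡0 = 4∤r (divides ℤ.∣ - x ∣ (begin
    r                  ≡⟨ cong ℤ.∣_∣ r≡4[-x] ⟩
    ℤ.∣ + 4 * - x ∣    ≡⟨ ℤₚ.abs-* (+ 4) (- x) ⟩
    4 ℕ.* ℤ.∣ - x ∣    ≡⟨ ℕₚ.*-comm 4 ℤ.∣ - x ∣ ⟩
    ℤ.∣ - x ∣ ℕ.* 4    ∎))
    where
    open ≡-Reasoning
    split : ∀ r x → r ≡ r + + 4 * x + + 4 * - x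
    split = solve-∀
    r≡4[-x] : + r ≡ + 4 * - x
    r≡4[-x] = trans (split (+ r) x) (trans (cong (_+ + 4 * - x) r+4x≡0) (ℤₚ.+-identityˡ _))

  ¬4∣1 : ¬ 4 ∣ 1
  ¬4∣1 = from-no (4 ∣? 1)

  ¬4∣2 : ¬ 4 ∣ 2
  ¬4∣2 = from-no (4 ∣? 2)

  ¬4∣3 : ¬ 4 ∣ 3
  ¬4∣3 = from-no (4 ∣? 3)

  ¬4∣7 : ¬ 4 ∣ 7
  ¬4∣7 = from-no (4 ∣? 7)

  m-n≢0 : ∀ {m n} → m ≢ n → + m + - + n ≢ 0ℤ
  m-n≢0 {m} {n} m≢n m-n≡0 = m≢n (ℤₚ.+-injective (ℤₚ.i-j≡0⇒i≡j (+ m) (+ n) m-n≡0))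

  cast-* : ∀ {a b c e} → a ℕ.* b ≡ c ℕ.* e → + a * + b ≡ + c * + e
  cast-* {a} {b} {c} {e} eq = trans (sym (ℤₚ.pos-* a b)) (trans (cong +_ eq) (ℤₚ.pos-* c e))

  sumToℤ-cong : ∀ n {f g : ℕ → ℤ} → (∀ {k} → k ℕ.≤ n → f k ≡ g k) → sumToℤ n f ≡ sumToℤ n g
  sumToℤ-cong zero    f≗g = f≗g z≤n
  sumToℤ-cong (suc n) f≗g = cong₂ _+_ (sumToℤ-cong n (λ k≤n → f≗g (ℕₚ.m≤n⇒m≤1+n k≤n))) (f≗g ℕₚ.≤-refl)

  sumToℤ-+ : ∀ n f g → sumToℤ n (λ k → f k + g k) ≡ sumToℤ n f + sumToℤ n g
  sumToℤ-+ zero    f g = refl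
  sumToℤ-+ (suc n) f g =
    trans (cong (_+ (f (suc n) + g (suc n))) (sumToℤ-+ n f g))
          (interchange (sumToℤ n f) (sumToℤ n g) (f (suc n)) (g (suc n)))
    where
    interchange : ∀ a b c d → (a + b) + (c + d) ≡ (a + c) + (b + d)
    interchange = solve-∀

  sumToℤ-*ˡ : ∀ n c f → sumToℤ n (λ k → c * f k) ≡ c * sumToℤ n f
  sumToℤ-*ˡ zero    c f = refl
  sumToℤ-*ˡ (suc n) c f = trans (cong (_+ c * f (suc n)) (sumToℤ-*ˡ n c f)) (sym (ℤₚ.*-distribˡ-+ c _ _))

  sumToℤ-extend : ∀ n f → f (suc n) ≡ 0ℤ → sumToℤ (suc n) f ≡ sumToℤ n f
  sumToℤ-extend n f f[1+n]≡0 = trans (cong (_+_ (sumToℤ n f)) f[1+n]≡0) (ℤₚ.+-identityʳ _)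

  module HypergeometricTerm
    (F f : ℕ → ℕ → ℤ) (X Y U V : ℕ → ℕ → ℤ)
    (F-diagonal : ∀ d k → F (d ℕ.+ k) k ≡ f d k)
    (F-vanish : ∀ {m k} → m ℕ.< k → F m k ≡ 0ℤ)
    (f-shiftₙ : ∀ d k → f d k * X (d ℕ.+ k) k ≡ f (suc d) k * Y (d ℕ.+ k) k)
    (f-shiftₖ : ∀ d k → f d (suc k) * V (suc d ℕ.+ k) k ≡ f (suc d) k * U (suc d ℕ.+ k) k)
    (Y-root : ∀ m → Y m (suc m) ≡ 0ℤ)
    (U-root : ∀ m → U m m ≡ 0ℤ)
    where

    open ≡-Reasoning

    F-shiftₙ : ∀ m k → F m k * X m k ≡ F (suc m) k * Y m k
    F-shiftₙ m k with k ℕ.≤? m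
    ... | yes k≤m = subst (λ m → F m k * X m k ≡ F (suc m) k * Y m k) (ℕₚ.m∸n+n≡m k≤m) (onSupport (m ℕ.∸ k))
      where
      onSupport : ∀ d → F (d ℕ.+ k) k * X (d ℕ.+ k) k ≡ F (suc d ℕ.+ k) k * Y (d ℕ.+ k) k
      onSupport d = begin
        F (d ℕ.+ k) k * X (d ℕ.+ k) k        ≡⟨ cong (_* X (d ℕ.+ k) k) (F-diagonal d k) ⟩
        f d k * X (d ℕ.+ k) k                ≡⟨ f-shiftₙ d k ⟩
        f (suc d) k * Y (d ℕ.+ k) k          ≡⟨ cong (_* Y (d ℕ.+ k) k) (F-diagonal (suc d) k) ⟨
        F (suc d ℕ.+ k) k * Y (d ℕ.+ k) k    ∎
    ... | no k≰m with ℕₚ.m≤n⇒m<n∨m≡n (ℕₚ.≰⇒> {k} {m} k≰m)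
    ...   | inj₁ 1+m<k = products-vanish (F-vanish (ℕₚ.≰⇒> {k} {m} k≰m)) (F-vanish 1+m<k)
    ...   | inj₂ refl  = products-vanish′ {k = F (suc m) (suc m)} (F-vanish (ℕₚ.n<1+n m)) (Y-root m)

    F-shiftₖ : ∀ m k → F m (suc k) * V m k ≡ F m k * U m k
    F-shiftₖ m k with suc k ℕ.≤? m
    ... | yes k<m = subst (λ m → F m (suc k) * V m k ≡ F m k * U m k) m≡1+d+k (onSupport (m ℕ.∸ suc k))
      where
      m≡1+d+k : suc (m ℕ.∸ suc k ℕ.+ k) ≡ m
      m≡1+d+k = trans (sym (ℕₚ.+-suc (m ℕ.∸ suc k) k)) (ℕₚ.m∸n+n≡m k<m)
      onSupport : ∀ d → F (suc d ℕ.+ k) (suc k) * V (suc d ℕ.+ k) k ≡ F (suc d ℕ.+ k) k * U (suc d ℕ.+ k) k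
      onSupport d = begin
        F (suc d ℕ.+ k) (suc k) * V′          ≡⟨ cong (λ m → F m (suc k) * V′) (ℕₚ.+-suc d k) ⟨
        F (d ℕ.+ suc k) (suc k) * V′          ≡⟨ cong (_* V′) (F-diagonal d (suc k)) ⟩
        f d (suc k) * V′                      ≡⟨ f-shiftₖ d k ⟩
        f (suc d) k * U (suc d ℕ.+ k) k       ≡⟨ cong (_* U (suc d ℕ.+ k) k) (F-diagonal (suc d) k) ⟨
        F (suc d ℕ.+ k) k * U (suc d ℕ.+ k) k ∎
        where V′ = V (suc d ℕ.+ k) k
    ... | no k≮m with ℕₚ.m≤n⇒m<n∨m≡n (ℕₚ.≤-pred (ℕₚ.≰⇒> {suc k} {m} k≮m))
    ...   | inj₁ m<k = products-vanish (F-vanish (ℕₚ.m<n⇒m<1+n m<k)) (F-vanish m<k)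
    ...   | inj₂ refl = products-vanish′ {k = F m m} (F-vanish (ℕₚ.n<1+n m)) (U-root m)

  module CreativeTelescoping
    (F X Y U V N D : ℕ → ℕ → ℤ) (p₀ p₁ p₂ : ℕ → ℤ)
    (F-vanish : ∀ {m k} → m ℕ.< k → F m k ≡ 0ℤ)
    (F-shiftₙ : ∀ m k → F m k * X m k ≡ F (suc m) k * Y m k)
    (F-shiftₖ : ∀ m k → F m (suc k) * V m k ≡ F m k * U m k)
    (X≢0 : ∀ m k → X m k ≢ 0ℤ)
    (U≢0 : ∀ {n j} → j ℕ.≤ suc n → U (2 ℕ.+ n) j ≢ 0ℤ)
    (D≢0 : ∀ {n j} → j ℕ.≤ 2 ℕ.+ n → D n j ≢ 0ℤ)
    (base : ∀ n →
      D n 0 * (p₀ n * (Y n 0 * Y (1 ℕ.+ n) 0) + p₁ n * (Y (1 ℕ.+ n) 0 * X n 0) + p₂ n * (X n 0 * X (1 ℕ.+ n) 0))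
        ≡ N n 0 * (X n 0 * X (1 ℕ.+ n) 0))
    (step : ∀ n j →
      D n (suc j) * (X n (suc j) * X (1 ℕ.+ n) (suc j) * V (2 ℕ.+ n) j * N n j
                     + D n j * U (2 ℕ.+ n) j
                       * (p₀ n * (Y n (suc j) * Y (1 ℕ.+ n) (suc j)) + p₁ n * (Y (1 ℕ.+ n) (suc j) * X n (suc j))
                          + p₂ n * (X n (suc j) * X (1 ℕ.+ n) (suc j))))
        ≡ N n (suc j) * D n j * U (2 ℕ.+ n) j * (X n (suc j) * X (1 ℕ.+ n) (suc j)))
    (end : ∀ n → N n (2 ℕ.+ n) ≡ 0ℤ)
    where

    open ≡-Reasoning

    S : ℕ → ℤ
    S n = sumToℤ n (F n)

    L : ℕ → ℕ → ℤ
    L n k = p₀ n * F n k + p₁ n * F (1 ℕ.+ n) k + p₂ n * F (2 ℕ.+ n) k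

    XX YY : ℕ → ℕ → ℤ
    XX n k = X n k * X (1 ℕ.+ n) k
    YY n k = Y n k * Y (1 ℕ.+ n) k

    ratio : ℕ → ℕ → ℤ
    ratio n k = p₀ n * YY n k + p₁ n * (Y (1 ℕ.+ n) k * X n k) + p₂ n * XX n k

    L-ratio : ∀ n k → L n k * XX n k ≡ F (2 ℕ.+ n) k * ratio n k
    L-ratio n k = begin
      L n k * XX n k
        ≡⟨ regroup (p₀ n) (p₁ n) (p₂ n) (F n k) (F (1 ℕ.+ n) k) (F (2 ℕ.+ n) k) (X n k) (X (1 ℕ.+ n) k) ⟩
      p₀ n * (F n k * X n k * X (1 ℕ.+ n) k) + p₁ n * (F (1 ℕ.+ n) k * X (1 ℕ.+ n) k) * X n k + p₂ n * F (2 ℕ.+ n) k * XX n k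
        ≡⟨ cong₂ (λ u v → p₀ n * u + p₁ n * v * X n k + p₂ n * F (2 ℕ.+ n) k * XX n k) F-shift₂ (F-shiftₙ (1 ℕ.+ n) k) ⟩
      p₀ n * (F (2 ℕ.+ n) k * Y (1 ℕ.+ n) k * Y n k) + p₁ n * (F (2 ℕ.+ n) k * Y (1 ℕ.+ n) k) * X n k + p₂ n * F (2 ℕ.+ n) k * XX n k
        ≡⟨ collect (p₀ n) (p₁ n) (p₂ n) (F (2 ℕ.+ n) k) (X n k) (X (1 ℕ.+ n) k) (Y n k) (Y (1 ℕ.+ n) k) ⟩
      F (2 ℕ.+ n) k * ratio n k ∎
      where
      F-shift₂ : F n k * X n k * X (1 ℕ.+ n) k ≡ F (2 ℕ.+ n) k * Y (1 ℕ.+ n) k * Y n k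
      F-shift₂ = begin
        F n k * X n k * X (1 ℕ.+ n) k         ≡⟨ cong (_* X (1 ℕ.+ n) k) (F-shiftₙ n k) ⟩
        F (1 ℕ.+ n) k * Y n k * X (1 ℕ.+ n) k ≡⟨ swap (F (1 ℕ.+ n) k) (Y n k) (X (1 ℕ.+ n) k) ⟩
        F (1 ℕ.+ n) k * X (1 ℕ.+ n) k * Y n k ≡⟨ cong (_* Y n k) (F-shiftₙ (1 ℕ.+ n) k) ⟩
        F (2 ℕ.+ n) k * Y (1 ℕ.+ n) k * Y n k ∎
        where
        swap : ∀ a b c → a * b * c ≡ a * c * b
        swap = solve-∀
      regroup : ∀ p₀ p₁ p₂ f₀ f₁ f₂ x₀ x₁ →
        (p₀ * f₀ + p₁ * f₁ + p₂ * f₂) * (x₀ * x₁)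
          ≡ p₀ * (f₀ * x₀ * x₁) + p₁ * (f₁ * x₁) * x₀ + p₂ * f₂ * (x₀ * x₁)
      regroup = solve-∀
      collect : ∀ p₀ p₁ p₂ f x₀ x₁ y₀ y₁ →
        p₀ * (f * y₁ * y₀) + p₁ * (f * y₁) * x₀ + p₂ * f * (x₀ * x₁)
          ≡ f * (p₀ * (y₀ * y₁) + p₁ * (y₁ * x₀) + p₂ * (x₀ * x₁))
      collect = solve-∀

    G : ℕ → ℕ → ℤ
    G n j = sumToℤ j (L n)

    G-closedForm : ∀ n j → j ℕ.≤ 2 ℕ.+ n → D n j * G n j ≡ N n j * F (2 ℕ.+ n) j
    G-closedForm n zero    _ = *-cancelʳ (XX n 0) (*-≢0 (X≢0 n 0) (X≢0 (1 ℕ.+ n) 0)) (begin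
      D n 0 * L n 0 * XX n 0              ≡⟨ ℤₚ.*-assoc (D n 0) (L n 0) (XX n 0) ⟩
      D n 0 * (L n 0 * XX n 0)            ≡⟨ cong (D n 0 *_) (L-ratio n 0) ⟩
      D n 0 * (F (2 ℕ.+ n) 0 * ratio n 0) ≡⟨ rotate (D n 0) (F (2 ℕ.+ n) 0) (ratio n 0) ⟩
      F (2 ℕ.+ n) 0 * (D n 0 * ratio n 0) ≡⟨ cong (F (2 ℕ.+ n) 0 *_) (base n) ⟩
      F (2 ℕ.+ n) 0 * (N n 0 * XX n 0)    ≡⟨ rotate (F (2 ℕ.+ n) 0) (N n 0) (XX n 0) ⟩
      N n 0 * (F (2 ℕ.+ n) 0 * XX n 0)    ≡⟨ ℤₚ.*-assoc (N n 0) (F (2 ℕ.+ n) 0) (XX n 0) ⟨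
      N n 0 * F (2 ℕ.+ n) 0 * XX n 0      ∎)
      where
      rotate : ∀ a b c → a * (b * c) ≡ b * (a * c)
      rotate = solve-∀
    G-closedForm n (suc j) (s≤s j≤1+n) = *-cancelʳ c c≢0 (begin
      D n (suc j) * (G n j + L n (suc j)) * c
        ≡⟨ expand (D n (suc j)) (G n j) (L n (suc j)) (D n j) U′ XX′ ⟩
      D n (suc j) * (U′ * (D n j * G n j) * XX′ + D n j * U′ * (L n (suc j) * XX′))
        ≡⟨ cong₂ (λ u v → D n (suc j) * (U′ * u * XX′ + D n j * U′ * v)) (G-closedForm n j j≤2+n) (L-ratio n (suc j)) ⟩
      D n (suc j) * (U′ * (N n j * Φ) * XX′ + D n j * U′ * (F′ * ratio n (suc j)))
        ≡⟨ pull (D n (suc j)) U′ (N n j) Φ XX′ (D n j) F′ (ratio n (suc j)) ⟩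
      D n (suc j) * (Φ * U′ * (XX′ * N n j) + F′ * (D n j * U′ * ratio n (suc j)))
        ≡⟨ cong (λ u → D n (suc j) * (u * (XX′ * N n j) + F′ * (D n j * U′ * ratio n (suc j)))) (F-shiftₖ (2 ℕ.+ n) j) ⟨
      D n (suc j) * (F′ * V′ * (XX′ * N n j) + F′ * (D n j * U′ * ratio n (suc j)))
        ≡⟨ push (D n (suc j)) F′ V′ XX′ (N n j) (D n j * U′ * ratio n (suc j)) ⟩
      F′ * (D n (suc j) * (XX′ * V′ * N n j + D n j * U′ * ratio n (suc j)))
        ≡⟨ cong (F′ *_) (step n j) ⟩
      F′ * (N n (suc j) * D n j * U′ * XX′)
        ≡⟨ finish F′ (N n (suc j)) (D n j) U′ XX′ ⟩
      N n (suc j) * F′ * c ∎)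
      where
      j≤2+n = ℕₚ.m≤n⇒m≤1+n j≤1+n
      U′ = U (2 ℕ.+ n) j
      V′ = V (2 ℕ.+ n) j
      XX′ = XX n (suc j)
      Φ = F (2 ℕ.+ n) j
      F′ = F (2 ℕ.+ n) (suc j)
      c = D n j * U′ * XX′
      c≢0 : c ≢ 0ℤ
      c≢0 = *-≢0 (*-≢0 (D≢0 j≤2+n) (U≢0 j≤1+n)) (*-≢0 (X≢0 n (suc j)) (X≢0 (1 ℕ.+ n) (suc j)))
      expand : ∀ d′ g l d u x → d′ * (g + l) * (d * u * x) ≡ d′ * (u * (d * g) * x + d * u * (l * x))
      expand = solve-∀
      pull : ∀ d′ u nn φ x d f r → d′ * (u * (nn * φ) * x + d * u * (f * r)) ≡ d′ * (φ * u * (x * nn) + f * (d * u * r))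
      pull = solve-∀
      push : ∀ d′ f v x nn w → d′ * (f * v * (x * nn) + f * w) ≡ f * (d′ * (x * v * nn + w))
      push = solve-∀
      finish : ∀ f nn d u x → f * (nn * d * u * x) ≡ nn * f * (d * u * x)
      finish = solve-∀

    G-vanishes : ∀ n → G n (2 ℕ.+ n) ≡ 0ℤ
    G-vanishes n = i*j≡0⇒j≡0 (D≢0 ℕₚ.≤-refl) (begin
      D n (2 ℕ.+ n) * G n (2 ℕ.+ n)      ≡⟨ G-closedForm n (2 ℕ.+ n) ℕₚ.≤-refl ⟩
      N n (2 ℕ.+ n) * F (2 ℕ.+ n) (2 ℕ.+ n) ≡⟨ cong (_* F (2 ℕ.+ n) (2 ℕ.+ n)) (end n) ⟩
      0ℤ * F (2 ℕ.+ n) (2 ℕ.+ n)         ≡⟨ ℤₚ.*-zeroˡ (F (2 ℕ.+ n) (2 ℕ.+ n)) ⟩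
      0ℤ                                 ∎)

    recurrence : ∀ n → p₀ n * S n + p₁ n * S (1 ℕ.+ n) + p₂ n * S (2 ℕ.+ n) ≡ 0ℤ
    recurrence n = begin
      p₀ n * S n + p₁ n * S (1 ℕ.+ n) + p₂ n * S (2 ℕ.+ n)
        ≡⟨ cong₂ (λ u v → p₀ n * u + p₁ n * v + p₂ n * S (2 ℕ.+ n)) S₀ S₁ ⟨
      p₀ n * sumToℤ (2 ℕ.+ n) (F n) + p₁ n * sumToℤ (2 ℕ.+ n) (F (1 ℕ.+ n)) + p₂ n * S (2 ℕ.+ n)
        ≡⟨ linear ⟨
      G n (2 ℕ.+ n)
        ≡⟨ G-vanishes n ⟩
      0ℤ ∎
      where
      S₀ : sumToℤ (2 ℕ.+ n) (F n) ≡ S n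
      S₀ = trans (sumToℤ-extend (1 ℕ.+ n) (F n) (F-vanish (ℕₚ.m<n⇒m<1+n (ℕₚ.n<1+n n))))
                 (sumToℤ-extend n (F n) (F-vanish (ℕₚ.n<1+n n)))
      S₁ : sumToℤ (2 ℕ.+ n) (F (1 ℕ.+ n)) ≡ S (1 ℕ.+ n)
      S₁ = sumToℤ-extend (1 ℕ.+ n) (F (1 ℕ.+ n)) (F-vanish (ℕₚ.n<1+n (1 ℕ.+ n)))
      linear : G n (2 ℕ.+ n) ≡ p₀ n * sumToℤ (2 ℕ.+ n) (F n) + p₁ n * sumToℤ (2 ℕ.+ n) (F (1 ℕ.+ n)) + p₂ n * S (2 ℕ.+ n)
      linear = begin
        G n (2 ℕ.+ n)
          ≡⟨ sumToℤ-+ (2 ℕ.+ n) (λ k → p₀ n * F n k + p₁ n * F (1 ℕ.+ n) k) (λ k → p₂ n * F (2 ℕ.+ n) k) ⟩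
        sumToℤ (2 ℕ.+ n) (λ k → p₀ n * F n k + p₁ n * F (1 ℕ.+ n) k) + sumToℤ (2 ℕ.+ n) (λ k → p₂ n * F (2 ℕ.+ n) k)
          ≡⟨ cong (_+ sumToℤ (2 ℕ.+ n) (λ k → p₂ n * F (2 ℕ.+ n) k))
                  (sumToℤ-+ (2 ℕ.+ n) (λ k → p₀ n * F n k) (λ k → p₁ n * F (1 ℕ.+ n) k)) ⟩
        sumToℤ (2 ℕ.+ n) (λ k → p₀ n * F n k) + sumToℤ (2 ℕ.+ n) (λ k → p₁ n * F (1 ℕ.+ n) k)
          + sumToℤ (2 ℕ.+ n) (λ k → p₂ n * F (2 ℕ.+ n) k)
          ≡⟨ cong₂ _+_ (cong₂ _+_ (sumToℤ-*ˡ (2 ℕ.+ n) (p₀ n) (F n)) (sumToℤ-*ˡ (2 ℕ.+ n) (p₁ n) (F (1 ℕ.+ n))))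
                       (sumToℤ-*ˡ (2 ℕ.+ n) (p₂ n) (F (2 ℕ.+ n))) ⟩
        p₀ n * sumToℤ (2 ℕ.+ n) (F n) + p₁ n * sumToℤ (2 ℕ.+ n) (F (1 ℕ.+ n)) + p₂ n * S (2 ℕ.+ n) ∎

  module ThreeTermRecurrence (p₀ q p₂ : ℕ → ℤ) (p₂≢0 : ∀ n → p₂ n ≢ 0ℤ) where

    Satisfies : (ℕ → ℤ) → Set
    Satisfies A = ∀ n → p₀ n * A n + q n * A (1 ℕ.+ n) + p₂ n * A (2 ℕ.+ n) ≡ 0ℤ

    recurrence-unique : ∀ {A C : ℕ → ℤ} → Satisfies A → Satisfies C → A 0 ≡ C 0 → A 1 ≡ C 1 → ∀ n → A n ≡ C n
    recurrence-unique {A} {C} A-rec C-rec eq₀ eq₁ n = proj₁ (agree n)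
      where
      step : ∀ n → A n ≡ C n → A (1 ℕ.+ n) ≡ C (1 ℕ.+ n) → A (2 ℕ.+ n) ≡ C (2 ℕ.+ n)
      step n eqₙ eqₙ₊₁ = *-cancelʳ (p₂ n) (p₂≢0 n) (begin
        A (2 ℕ.+ n) * p₂ n
          ≡⟨ isolate (p₀ n) (q n) (p₂ n) (A n) (A (1 ℕ.+ n)) (A (2 ℕ.+ n)) ⟩
        p₀ n * A n + q n * A (1 ℕ.+ n) + p₂ n * A (2 ℕ.+ n) - (p₀ n * A n + q n * A (1 ℕ.+ n))
          ≡⟨ cong₂ (λ u v → u - (p₀ n * v + q n * A (1 ℕ.+ n))) (trans (A-rec n) (sym (C-rec n))) eqₙ ⟩
        p₀ n * C n + q n * C (1 ℕ.+ n) + p₂ n * C (2 ℕ.+ n) - (p₀ n * C n + q n * A (1 ℕ.+ n))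
          ≡⟨ cong (λ v → p₀ n * C n + q n * C (1 ℕ.+ n) + p₂ n * C (2 ℕ.+ n) - (p₀ n * C n + q n * v)) eqₙ₊₁ ⟩
        p₀ n * C n + q n * C (1 ℕ.+ n) + p₂ n * C (2 ℕ.+ n) - (p₀ n * C n + q n * C (1 ℕ.+ n))
          ≡⟨ isolate (p₀ n) (q n) (p₂ n) (C n) (C (1 ℕ.+ n)) (C (2 ℕ.+ n)) ⟨
        C (2 ℕ.+ n) * p₂ n ∎)
        where
        open ≡-Reasoning
        isolate : ∀ p₀ q p₂ a₀ a₁ a₂ → a₂ * p₂ ≡ p₀ * a₀ + q * a₁ + p₂ * a₂ - (p₀ * a₀ + q * a₁)
        isolate = solve-∀
      agree : ∀ n → A n ≡ C n × A (1 ℕ.+ n) ≡ C (1 ℕ.+ n)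
      agree zero    = eq₀ , eq₁
      agree (suc n) = let eqₙ , eqₙ₊₁ = agree n in eqₙ₊₁ , step n eqₙ eqₙ₊₁

    scaled-satisfies : ∀ {B : ℕ → ℤ} (f p₀′ p₂′ : ℕ → ℤ) →
      (∀ n → p₀′ n * B n + q n * B (1 ℕ.+ n) + p₂′ n * B (2 ℕ.+ n) ≡ 0ℤ) →
      (∀ n → p₀ n * (f n * f n) ≡ f (1 ℕ.+ n) * f (1 ℕ.+ n) * p₀′ n) →
      (∀ n → p₂ n * (f (2 ℕ.+ n) * f (2 ℕ.+ n)) ≡ f (1 ℕ.+ n) * f (1 ℕ.+ n) * p₂′ n) →
      Satisfies (λ n → f n * f n * B n)
    scaled-satisfies {B} f p₀′ p₂′ B-rec coeff₀ coeff₂ n = begin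
      p₀ n * (f n * f n * B n) + q n * (f₁ * f₁ * B (1 ℕ.+ n)) + p₂ n * (f₂ * f₂ * B (2 ℕ.+ n))
        ≡⟨ regroup (p₀ n) (q n) (p₂ n) (f n) f₁ f₂ (B n) (B (1 ℕ.+ n)) (B (2 ℕ.+ n)) ⟩
      p₀ n * (f n * f n) * B n + q n * (f₁ * f₁ * B (1 ℕ.+ n)) + p₂ n * (f₂ * f₂) * B (2 ℕ.+ n)
        ≡⟨ cong₂ (λ u v → u * B n + q n * (f₁ * f₁ * B (1 ℕ.+ n)) + v * B (2 ℕ.+ n)) (coeff₀ n) (coeff₂ n) ⟩
      f₁ * f₁ * p₀′ n * B n + q n * (f₁ * f₁ * B (1 ℕ.+ n)) + f₁ * f₁ * p₂′ n * B (2 ℕ.+ n)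
        ≡⟨ factor (f₁ * f₁) (p₀′ n) (q n) (p₂′ n) (B n) (B (1 ℕ.+ n)) (B (2 ℕ.+ n)) ⟩
      f₁ * f₁ * (p₀′ n * B n + q n * B (1 ℕ.+ n) + p₂′ n * B (2 ℕ.+ n))
        ≡⟨ cong (f₁ * f₁ *_) (B-rec n) ⟩
      f₁ * f₁ * 0ℤ
        ≡⟨ ℤₚ.*-zeroʳ (f₁ * f₁) ⟩
      0ℤ ∎
      where
      open ≡-Reasoning
      f₁ = f (1 ℕ.+ n)
      f₂ = f (2 ℕ.+ n)
      regroup : ∀ p₀ q p₂ f f₁ f₂ b₀ b₁ b₂ → p₀ * (f * f * b₀) + q * (f₁ * f₁ * b₁) + p₂ * (f₂ * f₂ * b₂)
                                            ≡ p₀ * (f * f) * b₀ + q * (f₁ * f₁ * b₁) + p₂ * (f₂ * f₂) * b₂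
      regroup = solve-∀
      factor : ∀ g p₀ q p₂ b₀ b₁ b₂ → g * p₀ * b₀ + q * (g * b₁) + g * p₂ * b₂ ≡ g * (p₀ * b₀ + q * b₁ + p₂ * b₂)
      factor = solve-∀

module PolynomialCertificates where

  open import Data.Nat using (ℕ)
  open import Data.Fin using (zero; suc)
  open import Data.Vec using ([])
  open import Data.Product using (_×_; _,_; proj₁; proj₂)
  open import Data.Integer using (ℤ; +_; 0ℤ)
  import Data.Integer.Properties as ℤₚ
  open import Data.Integer.Tactic.RingSolver using (ring)
  open import Tactic.RingSolver.NonReflective ring public using (Expr; Κ; Ι; _⊕_; _⊗_; _⊛_; ⊝_)
  open import Tactic.RingSolver.NonReflective ring using (module Ops)
  open Ops using (⟦_⟧; ⟦_⇓⟧; correct)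
  open import Relation.Binary.PropositionalEquality

  Poly₁ Poly₂ : Set
  Poly₁ = ∀ {v} → Expr ℤ v → Expr ℤ v
  Poly₂ = ∀ {v} → Expr ℤ v → Expr ℤ v → Expr ℤ v

  infixl 6 _⊖_
  infixl 8 _²

  # : ∀ {v} → ℕ → Expr ℤ v
  # n = Κ (+ n)

  _⊖_ : ∀ {v} → Expr ℤ v → Expr ℤ v → Expr ℤ v
  x ⊖ y = x ⊕ ⊝ y

  _² : ∀ {v} → Expr ℤ v → Expr ℤ v
  x ² = x ⊗ x

  eval₁ : Poly₁ → ℕ → ℤ
  eval₁ P n = ⟦ P (Κ (+ n)) ⟧ []

  eval₂ : Poly₂ → ℕ → ℕ → ℤ
  eval₂ P m k = ⟦ P (Κ (+ m)) (Κ (+ k)) ⟧ []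

  Identity : ℕ → Set
  Identity v = Expr ℤ v × Expr ℤ v

  -- Rather than comparing the two normal forms at symbolic arguments, as `solve` does, the
  -- normal form of l - r is compared with 0 by a closed computation: this keeps the check of the
  -- large certificate identities fast.
  byNormalisation : ∀ {v} (e : Identity v) → (∀ ρ → ⟦ proj₁ e ⊖ proj₂ e ⇓⟧ ρ ≡ 0ℤ) →
                    ∀ ρ → ⟦ proj₁ e ⟧ ρ ≡ ⟦ proj₂ e ⟧ ρ
  byNormalisation (l , r) normal ρ = ℤₚ.i-j≡0⇒i≡j _ _ (trans (sym (correct (l ⊖ r) ρ)) (normal ρ))

  -- For a summand F: F(m+1,k) / F(m,k) = X(m,k) / Y(m,k) and F(m,k+1) / F(m,k) = U(m,k) / V(m,k);
  -- p₀, p₁, p₂ are the coefficients of the recurrence, and N(n,j) / D(n,j) is the rational factor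
  -- turning F(n+2,j) into the partial sum up to j of p₀ F(n,·) + p₁ F(n+1,·) + p₂ F(n+2,·).
  record Certificate : Set where
    field
      X Y U V N D : Poly₂
      p₀ p₁ p₂ : Poly₁

  module _ (C : Certificate) where
    open Certificate C

    baseIdentity : Identity 1
    baseIdentity =
      D a z ⊗ (p₀ a ⊗ (Y a z ⊗ Y a₁ z) ⊕ p₁ a ⊗ (Y a₁ z ⊗ X a z) ⊕ p₂ a ⊗ (X a z ⊗ X a₁ z)) ,
      N a z ⊗ (X a z ⊗ X a₁ z)
      where
      a a₁ z : Expr ℤ 1
      a = Ι zero
      a₁ = # 1 ⊕ a
      z = # 0

    stepIdentity : Identity 2
    stepIdentity =
      D a b₁ ⊗ (X a b₁ ⊗ X a₁ b₁ ⊗ V a₂ b ⊗ N a b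
                ⊕ D a b ⊗ U a₂ b
                  ⊗ (p₀ a ⊗ (Y a b₁ ⊗ Y a₁ b₁) ⊕ p₁ a ⊗ (Y a₁ b₁ ⊗ X a b₁) ⊕ p₂ a ⊗ (X a b₁ ⊗ X a₁ b₁))) ,
      N a b₁ ⊗ D a b ⊗ U a₂ b ⊗ (X a b₁ ⊗ X a₁ b₁)
      where
      a a₁ a₂ b b₁ : Expr ℤ 2
      a = Ι zero
      a₁ = # 1 ⊕ a
      a₂ = # 2 ⊕ a
      b = Ι (suc zero)
      b₁ = # 1 ⊕ b

    endIdentity : Identity 1
    endIdentity = N (Ι zero) (# 2 ⊕ Ι zero) , # 0

module Binomials where

  open import Data.Nat using (ℕ; suc; _+_; _*_; _∸_; _!; _≤_)
  import Data.Nat.Properties as ℕₚ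
  open import Data.Nat.Combinatorics using (_C_; nCk≡n!/k![n-k]!; k![n∸k]!∣n!)
  open import Data.Nat.DivMod using (m/n*n≡m)
  open import Data.Nat.Tactic.RingSolver using (solve-∀)
  import Data.Integer as ℤ
  open import Relation.Binary.PropositionalEquality
  open IntegerSequences using (cast-*)

  open ≡-Reasoning

  C-factorial : ∀ {n k} → k ≤ n → (n C k) * (k ! * (n ∸ k) !) ≡ n !
  C-factorial {n} {k} k≤n =
    trans (cong (_* (k ! * (n ∸ k) !)) (nCk≡n!/k![n-k]! k≤n))
          (m/n*n≡m {{ℕₚ._!*_!≢0 k (n ∸ k)}} (k![n∸k]!∣n! k≤n))

  C-central : ∀ j → ((2 * j) C j) * (j ! * j !) ≡ (2 * j) !
  C-central j = subst (λ i → ((2 * j) C j) * (j ! * i !) ≡ (2 * j) !) 2j∸j≡j (C-factorial (ℕₚ.m≤m+n j (j + 0)))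
    where
    2j∸j≡j : 2 * j ∸ j ≡ j
    2j∸j≡j = trans (ℕₚ.m+n∸m≡n j (j + 0)) (ℕₚ.+-identityʳ j)

  B : ℕ → ℕ → ℕ
  B d k = (d + k) C k

  B-factorial : ∀ d k → B d k * (d ! * k !) ≡ (d + k) !
  B-factorial d k = begin
    B d k * (d ! * k !)              ≡⟨ cong (B d k *_) (ℕₚ.*-comm (d !) (k !)) ⟩
    B d k * (k ! * d !)              ≡⟨ cong (λ i → B d k * (k ! * i !)) (ℕₚ.m+n∸n≡m d k) ⟨
    B d k * (k ! * (d + k ∸ k) !)    ≡⟨ C-factorial (ℕₚ.m≤n+m k d) ⟩
    (d + k) !                        ∎

  B-sucˡ : ∀ d k → B (suc d) k * suc d ≡ B d k * suc (d + k)
  B-sucˡ d k = ℕₚ.*-cancelʳ-≡ _ _ (d ! * k !) {{ℕₚ._!*_!≢0 d k}} (begin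
    B (suc d) k * suc d * (d ! * k !)    ≡⟨ shuffle (B (suc d) k) (suc d) (d !) (k !) ⟩
    B (suc d) k * (suc d ! * k !)        ≡⟨ B-factorial (suc d) k ⟩
    suc (d + k) * (d + k) !              ≡⟨ cong (suc (d + k) *_) (B-factorial d k) ⟨
    suc (d + k) * (B d k * (d ! * k !))  ≡⟨ ℕₚ.*-assoc (suc (d + k)) (B d k) (d ! * k !) ⟨
    suc (d + k) * B d k * (d ! * k !)    ≡⟨ cong (_* (d ! * k !)) (ℕₚ.*-comm (suc (d + k)) (B d k)) ⟩
    B d k * suc (d + k) * (d ! * k !)    ∎)
    where
    shuffle : ∀ b s f g → b * s * (f * g) ≡ b * (s * f * g)
    shuffle = solve-∀

  B-sucʳ : ∀ d k → B d (suc k) * suc k ≡ B d k * suc (d + k)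
  B-sucʳ d k = ℕₚ.*-cancelʳ-≡ _ _ (d ! * k !) {{ℕₚ._!*_!≢0 d k}} (begin
    B d (suc k) * suc k * (d ! * k !)    ≡⟨ shuffle (B d (suc k)) (suc k) (d !) (k !) ⟩
    B d (suc k) * (d ! * suc k !)        ≡⟨ B-factorial d (suc k) ⟩
    (d + suc k) !                        ≡⟨ cong _! (ℕₚ.+-suc d k) ⟩
    suc (d + k) * (d + k) !              ≡⟨ cong (suc (d + k) *_) (B-factorial d k) ⟨
    suc (d + k) * (B d k * (d ! * k !))  ≡⟨ ℕₚ.*-assoc (suc (d + k)) (B d k) (d ! * k !) ⟨
    suc (d + k) * B d k * (d ! * k !)    ≡⟨ cong (_* (d ! * k !)) (ℕₚ.*-comm (suc (d + k)) (B d k)) ⟩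
    B d k * suc (d + k) * (d ! * k !)    ∎)
    where
    shuffle : ∀ b s f g → b * s * (f * g) ≡ b * (f * (s * g))
    shuffle = solve-∀

  c₄ : ℕ → ℕ
  c₄ k = ((4 * k) C (2 * k)) * ((2 * k) C k) * ((2 * k) C k)

  c₄-factorial : ∀ k → c₄ k * ((k ! * k !) * (k ! * k !)) ≡ (4 * k) !
  c₄-factorial k = begin
    c₄ k * ((k ! * k !) * (k ! * k !))
      ≡⟨ regroup ((4 * k) C (2 * k)) ((2 * k) C k) (k ! * k !) ⟩
    ((4 * k) C (2 * k)) * (((2 * k) C k) * (k ! * k !) * (((2 * k) C k) * (k ! * k !)))
      ≡⟨ cong (λ i → ((4 * k) C (2 * k)) * (i * i)) (C-central k) ⟩
    ((4 * k) C (2 * k)) * ((2 * k) ! * (2 * k) !)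
      ≡⟨ subst (λ i → (i C (2 * k)) * ((2 * k) ! * (2 * k) !) ≡ i !) (2[2k]≡4k k) (C-central (2 * k)) ⟩
    (4 * k) ! ∎
    where
    regroup : ∀ a c f → a * c * c * (f * f) ≡ a * (c * f * (c * f))
    regroup = solve-∀
    2[2k]≡4k : ∀ k → 2 * (2 * k) ≡ 4 * k
    2[2k]≡4k = solve-∀

  c₄-suc : ∀ k → c₄ (suc k) * (suc k * suc k * suc k * suc k)
               ≡ c₄ k * ((1 + 4 * k) * (2 + 4 * k) * (3 + 4 * k) * (4 + 4 * k))
  c₄-suc k = ℕₚ.*-cancelʳ-≡ _ _ k!⁴ {{k!⁴≢0}} (begin
    c₄ (suc k) * (suc k * suc k * suc k * suc k) * k!⁴
      ≡⟨ regroup (c₄ (suc k)) (suc k) (k !) ⟩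
    c₄ (suc k) * ((suc k ! * suc k !) * (suc k ! * suc k !))
      ≡⟨ c₄-factorial (suc k) ⟩
    (4 * suc k) !
      ≡⟨ cong _! (4[1+k]≡4+4k k) ⟩
    (4 + 4 * k) * ((3 + 4 * k) * ((2 + 4 * k) * ((1 + 4 * k) * (4 * k) !)))
      ≡⟨ cong (λ i → (4 + 4 * k) * ((3 + 4 * k) * ((2 + 4 * k) * ((1 + 4 * k) * i)))) (c₄-factorial k) ⟨
    (4 + 4 * k) * ((3 + 4 * k) * ((2 + 4 * k) * ((1 + 4 * k) * (c₄ k * k!⁴))))
      ≡⟨ collect (c₄ k) (4 * k) k!⁴ ⟩
    c₄ k * ((1 + 4 * k) * (2 + 4 * k) * (3 + 4 * k) * (4 + 4 * k)) * k!⁴ ∎)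
    where
    k!⁴ = (k ! * k !) * (k ! * k !)
    k!⁴≢0 = ℕₚ.m*n≢0 (k ! * k !) (k ! * k !) {{ℕₚ._!*_!≢0 k k}} {{ℕₚ._!*_!≢0 k k}}
    regroup : ∀ c s f → c * (s * s * s * s) * ((f * f) * (f * f)) ≡ c * ((s * f * (s * f)) * (s * f * (s * f)))
    regroup = solve-∀
    4[1+k]≡4+4k : ∀ k → 4 * suc k ≡ 4 + 4 * k
    4[1+k]≡4+4k = solve-∀
    collect : ∀ c t f → (4 + t) * ((3 + t) * ((2 + t) * ((1 + t) * (c * f))))
                         ≡ c * ((1 + t) * (2 + t) * (3 + t) * (4 + t)) * f
    collect = solve-∀

  B-sucˡᶻ : ∀ d k → ℤ.+ B (suc d) k ℤ.* (ℤ.+ 1 ℤ.+ ℤ.+ d) ≡ ℤ.+ B d k ℤ.* (ℤ.+ 1 ℤ.+ (ℤ.+ d ℤ.+ ℤ.+ k))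
  B-sucˡᶻ d k = cast-* {B (suc d) k} {suc d} {B d k} {suc (d + k)} (B-sucˡ d k)

  B-sucʳᶻ : ∀ d k → ℤ.+ B d (suc k) ℤ.* (ℤ.+ 1 ℤ.+ ℤ.+ k) ≡ ℤ.+ B d k ℤ.* (ℤ.+ 1 ℤ.+ (ℤ.+ d ℤ.+ ℤ.+ k))
  B-sucʳᶻ d k = cast-* {B d (suc k)} {suc k} {B d k} {suc (d + k)} (B-sucʳ d k)

  B-swapᶻ : ∀ d k → ℤ.+ B d (suc k) ℤ.* (ℤ.+ 1 ℤ.+ ℤ.+ k) ≡ ℤ.+ B (suc d) k ℤ.* (ℤ.+ 1 ℤ.+ ℤ.+ d)
  B-swapᶻ d k = cast-* {B d (suc k)} {suc k} {B (suc d) k} {suc d} (trans (B-sucʳ d k) (sym (B-sucˡ d k)))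

module LeftSum where

  open import Data.Nat as ℕ using (ℕ; zero; suc; s≤s; _∸_)
  import Data.Nat.Properties as ℕₚ
  open import Data.Nat.Combinatorics using (_C_; k>n⇒nCk≡0)
  open import Data.Fin using (zero; suc)
  open import Data.Vec using ([]; _∷_)
  open import Data.Product using (_,_)
  open import Data.Integer using (ℤ; +_; -_; _+_; _*_; _^_; 0ℤ)
  import Data.Integer.Properties as ℤₚ
  open import Data.Integer.Tactic.RingSolver using (solve-∀)
  open import Relation.Binary.PropositionalEquality
  open import Defs using (sumToℤ)
  open IntegerSequences
  open PolynomialCertificates
  open Binomials using (B; B-sucˡᶻ; B-swapᶻ)

  -- poch₄ r k = 4ᵏ (r/4)ₖ
  poch₄ : ℕ → ℕ → ℤ
  poch₄ r zero    = + 1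
  poch₄ r (suc k) = poch₄ r k * (+ r + + 4 * + k)

  leftTerm : ℕ → ℕ → ℤ
  leftTerm m k = (- + 4) ^ m * (w * w)
    where w = + (m C k) * poch₄ 1 k * poch₄ 3 (m ∸ k)

  leftSupport : ℕ → ℕ → ℤ
  leftSupport d k = (- + 4) ^ (d ℕ.+ k) * (w * w)
    where w = + B d k * poch₄ 1 k * poch₄ 3 d

  leftCertificate : Certificate
  leftCertificate = record
    { X  = λ a b → ⊝ # 4 ⊗ (# 1 ⊕ a) ² ⊗ (# 3 ⊕ # 4 ⊗ (a ⊖ b)) ²
    ; Y  = λ a b → (# 1 ⊕ a ⊖ b) ²
    ; U  = λ a b → (# 1 ⊕ # 4 ⊗ b) ² ⊗ (a ⊖ b) ²
    ; V  = λ a b → (# 1 ⊕ b) ² ⊗ (# 4 ⊗ (a ⊖ b) ⊖ # 1) ²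
    ; N  = λ a b → (# 2 ⊕ a ⊖ b) ⊗ (# 1 ⊕ # 4 ⊗ b)
                   ⊗ (# 8 ⊕ # 32 ⊗ b ⊖ # 18 ⊗ b ⊛ 2 ⊖ # 64 ⊗ b ⊛ 3 ⊕ # 32 ⊗ b ⊛ 4
                      ⊕ (# 14 ⊕ # 69 ⊗ b ⊕ # 36 ⊗ b ⊛ 2 ⊖ # 64 ⊗ b ⊛ 3) ⊗ a
                      ⊕ (# 5 ⊕ # 28 ⊗ b ⊕ # 32 ⊗ b ⊛ 2) ⊗ a ⊛ 2)
    ; D  = λ a b → (# 2 ⊕ a) ² ⊗ (# 3 ⊕ # 4 ⊗ (a ⊖ b)) ² ⊗ (# 7 ⊕ # 4 ⊗ (a ⊖ b)) ²
    ; p₀ = λ a → # 4096 ⊗ (# 1 ⊕ a) ⊛ 5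
    ; p₁ = λ a → # 8 ⊗ (# 3 ⊕ # 2 ⊗ a) ⊗ (# 21 ⊕ # 24 ⊗ a ⊕ # 8 ⊗ a ⊛ 2)
    ; p₂ = λ a → # 2 ⊕ a
    }

  open Certificate leftCertificate

  leftTerm-diagonal : ∀ d k → leftTerm (d ℕ.+ k) k ≡ leftSupport d k
  leftTerm-diagonal d k = cong (λ i → (- + 4) ^ (d ℕ.+ k) * (w i * w i)) (ℕₚ.m+n∸n≡m d k)
    where w = λ i → + B d k * poch₄ 1 k * poch₄ 3 i

  leftTerm-vanish : ∀ {m k} → m ℕ.< k → leftTerm m k ≡ 0ℤ
  leftTerm-vanish {m} {k} m<k =
    trans (cong (λ c → (- + 4) ^ m * (w c * w c)) (k>n⇒nCk≡0 m<k)) (ℤₚ.*-zeroʳ ((- + 4) ^ m))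
    where w = λ c → + c * poch₄ 1 k * poch₄ 3 (m ∸ k)

  leftSupport-shiftₙ : ∀ d k → leftSupport d k * eval₂ X (d ℕ.+ k) k ≡ leftSupport (suc d) k * eval₂ Y (d ℕ.+ k) k
  leftSupport-shiftₙ d k = begin
    leftSupport d k * eval₂ X (d ℕ.+ k) k
      ≡⟨ regroup s (+ B d k) p q A T ⟩
    - + 4 * s * (p * q * T * (+ B d k * A) * (p * q * T * (+ B d k * A)))
      ≡⟨ cong₂ (λ t u → - + 4 * s * (p * q * t * u * (p * q * t * u))) (T≡ (+ d) (+ k)) (sym (B-sucˡᶻ d k)) ⟩
    - + 4 * s * (p * q * T′ * (+ B (suc d) k * A′) * (p * q * T′ * (+ B (suc d) k * A′)))
      ≡⟨ regroup′ s (+ B (suc d) k) p q A′ T′ ⟩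
    leftSupport (suc d) k * (A′ * A′)
      ≡⟨ cong (λ y → leftSupport (suc d) k * (y * y)) (Y≡ (+ d) (+ k)) ⟨
    leftSupport (suc d) k * eval₂ Y (d ℕ.+ k) k ∎
    where
    open ≡-Reasoning
    s = (- + 4) ^ (d ℕ.+ k)
    p = poch₄ 1 k
    q = poch₄ 3 d
    A = + 1 + (+ d + + k)
    T = + 3 + + 4 * (+ d + + k + - + k)
    A′ = + 1 + + d
    T′ = + 3 + + 4 * + d
    regroup : ∀ s b p q A T → s * (b * p * q * (b * p * q)) * (- + 4 * (A * A) * (T * T))
                             ≡ - + 4 * s * (p * q * T * (b * A) * (p * q * T * (b * A)))
    regroup = solve-∀
    regroup′ : ∀ s b p q A T → - + 4 * s * (p * q * T * (b * A) * (p * q * T * (b * A)))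
                              ≡ - + 4 * s * (b * p * (q * T) * (b * p * (q * T))) * (A * A)
    regroup′ = solve-∀
    T≡ : ∀ d k → + 3 + + 4 * (d + k + - k) ≡ + 3 + + 4 * d
    T≡ = solve-∀
    Y≡ : ∀ d k → + 1 + (d + k) + - k ≡ + 1 + d
    Y≡ = solve-∀

  leftSupport-shiftₖ : ∀ d k → leftSupport d (suc k) * eval₂ V (suc d ℕ.+ k) k ≡ leftSupport (suc d) k * eval₂ U (suc d ℕ.+ k) k
  leftSupport-shiftₖ d k = begin
    leftSupport d (suc k) * eval₂ V (suc d ℕ.+ k) k
      ≡⟨ cong (λ e → (- + 4) ^ e * (w * w) * eval₂ V (suc d ℕ.+ k) k) (ℕₚ.+-suc d k) ⟩
    s * (w * w) * eval₂ V (suc d ℕ.+ k) k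
      ≡⟨ regroup s (+ B d (suc k)) p q R T K₁ ⟩
    s * (p * q * K₁ * T * (+ B d (suc k) * R) * (p * q * K₁ * T * (+ B d (suc k) * R)))
      ≡⟨ cong₂ (λ t u → s * (p * q * K₁ * t * u * (p * q * K₁ * t * u))) (T≡ (+ d) (+ k))
               (B-swapᶻ d k) ⟩
    s * (p * q * K₁ * T′ * (+ B (suc d) k * A′) * (p * q * K₁ * T′ * (+ B (suc d) k * A′)))
      ≡⟨ regroup′ s (+ B (suc d) k) p q A′ T′ K₁ ⟩
    leftSupport (suc d) k * (K₁ * K₁ * (A′ * A′))
      ≡⟨ cong (λ y → leftSupport (suc d) k * (K₁ * K₁ * (y * y))) (Y≡ (+ d) (+ k)) ⟨
    leftSupport (suc d) k * eval₂ U (suc d ℕ.+ k) k ∎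
    where
    open ≡-Reasoning
    s = (- + 4) ^ suc (d ℕ.+ k)
    p = poch₄ 1 k
    q = poch₄ 3 d
    w = + B d (suc k) * (p * (+ 1 + + 4 * + k)) * q
    R = + 1 + + k
    K₁ = + 1 + + 4 * + k
    T = + 4 * (+ 1 + (+ d + + k) + - + k) + - + 1
    A′ = + 1 + + d
    T′ = + 3 + + 4 * + d
    regroup : ∀ s b p q R T K → s * (b * (p * K) * q * (b * (p * K) * q)) * (R * R * (T * T))
                               ≡ s * (p * q * K * T * (b * R) * (p * q * K * T * (b * R)))
    regroup = solve-∀
    regroup′ : ∀ s b p q A T K → s * (p * q * K * T * (b * A) * (p * q * K * T * (b * A)))
                                ≡ s * (b * p * (q * T) * (b * p * (q * T))) * (K * K * (A * A))
    regroup′ = solve-∀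
    T≡ : ∀ d k → + 4 * (+ 1 + (d + k) + - k) + - + 1 ≡ + 3 + + 4 * d
    T≡ = solve-∀
    Y≡ : ∀ d k → + 1 + (d + k) + - k ≡ + 1 + d
    Y≡ = solve-∀

  X≢0 : ∀ m k → eval₂ X m k ≢ 0ℤ
  X≢0 m k = *-≢0 (*-≢0 {i = - + 4} (λ ()) (sq-≢0 (+ 1 + + m) (λ ()))) (sq-≢0 _ (r+4x≢0 (+ m + - + k) ¬4∣3))

  U≢0 : ∀ {n j} → j ℕ.≤ suc n → eval₂ U (2 ℕ.+ n) j ≢ 0ℤ
  U≢0 {n} {j} j≤1+n =
    *-≢0 (sq-≢0 _ (r+4x≢0 (+ j) ¬4∣1)) (sq-≢0 _ (m-n≢0 (λ 2+n≡j → ℕₚ.<-irrefl (sym 2+n≡j) (s≤s j≤1+n))))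

  D≢0 : ∀ {n j} → j ℕ.≤ 2 ℕ.+ n → eval₂ D n j ≢ 0ℤ
  D≢0 {n} {j} _ =
    *-≢0 (*-≢0 (sq-≢0 (+ 2 + + n) (λ ())) (sq-≢0 _ (r+4x≢0 (+ n + - + j) ¬4∣3))) (sq-≢0 _ (r+4x≢0 (+ n + - + j) ¬4∣7))

  Y-root : ∀ m → eval₂ Y m (suc m) ≡ 0ℤ
  Y-root m = byNormalisation (Y (Ι zero) (# 1 ⊕ Ι zero) , # 0) (λ _ → refl) (+ m ∷ [])

  U-root : ∀ m → eval₂ U m m ≡ 0ℤ
  U-root m = byNormalisation (U (Ι zero) (Ι zero) , # 0) (λ _ → refl) (+ m ∷ [])

  module Shifts = HypergeometricTerm leftTerm leftSupport (eval₂ X) (eval₂ Y) (eval₂ U) (eval₂ V)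
    leftTerm-diagonal leftTerm-vanish leftSupport-shiftₙ leftSupport-shiftₖ Y-root U-root

  module Telescoping = CreativeTelescoping leftTerm (eval₂ X) (eval₂ Y) (eval₂ U) (eval₂ V) (eval₂ N) (eval₂ D)
    (eval₁ p₀) (eval₁ p₁) (eval₁ p₂)
    leftTerm-vanish Shifts.F-shiftₙ Shifts.F-shiftₖ X≢0 U≢0 D≢0
    (λ n → byNormalisation (baseIdentity leftCertificate) (λ _ → refl) (+ n ∷ []))
    (λ n j → byNormalisation (stepIdentity leftCertificate) (λ _ → refl) (+ n ∷ + j ∷ []))
    (λ n → byNormalisation (endIdentity leftCertificate) (λ _ → refl) (+ n ∷ []))

  leftSum : ℕ → ℤ
  leftSum n = sumToℤ n (leftTerm n)

  leftSum-recurrence : ∀ n →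
    eval₁ p₀ n * leftSum n + eval₁ p₁ n * leftSum (1 ℕ.+ n) + eval₁ p₂ n * leftSum (2 ℕ.+ n) ≡ 0ℤ
  leftSum-recurrence = Telescoping.recurrence

module RightSum where

  open import Data.Nat as ℕ using (ℕ; zero; suc; s≤s; _∸_)
  import Data.Nat.Properties as ℕₚ
  open import Data.Nat.Combinatorics using (_C_; k>n⇒nCk≡0; nCk≡nC[n∸k])
  open import Data.Fin using (zero; suc)
  open import Data.Vec using ([]; _∷_)
  open import Data.Product using (_,_)
  open import Data.Integer using (ℤ; +_; -_; -[1+_]; _+_; _*_; _^_; 0ℤ)
  import Data.Integer.Properties as ℤₚ
  open import Data.Integer.Tactic.RingSolver using (solve-∀)
  open import Relation.Binary.PropositionalEquality
  open import Defs using (sumToℤ)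
  open IntegerSequences
  open PolynomialCertificates
  open Binomials using (B; c₄; c₄-suc; B-sucˡᶻ; B-sucʳᶻ; B-swapᶻ)
  open LeftSum using (leftCertificate)

  rightTerm : ℕ → ℕ → ℤ
  rightTerm m k = + (c₄ k ℕ.* ((m ℕ.+ k) C (2 ℕ.* k))) * (- + 64) ^ (m ∸ k)

  rightSupport : ℕ → ℕ → ℤ
  rightSupport d k = + (c₄ k ℕ.* B d (k ℕ.+ k)) * (- + 64) ^ d

  rightCertificate : Certificate
  rightCertificate = record
    { X  = λ a b → ⊝ # 64 ⊗ (# 1 ⊕ a ⊕ b)
    ; Y  = λ a b → # 1 ⊕ a ⊖ b
    ; U  = λ a b → (# 1 ⊕ # 4 ⊗ b) ⊗ (# 2 ⊕ # 4 ⊗ b) ⊗ (# 3 ⊕ # 4 ⊗ b) ⊗ (# 4 ⊗ (# 1 ⊕ b))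
                   ⊗ (# 1 ⊕ a ⊕ b) ⊗ (a ⊖ b)
    ; V  = λ a b → ⊝ # 64 ⊗ (# 1 ⊕ b) ² ² ⊗ (# 1 ⊕ # 2 ⊗ b) ⊗ (# 2 ⊕ # 2 ⊗ b)
    ; N  = λ a b → (# 2 ⊕ a ⊖ b) ⊗ (# 1 ⊕ # 4 ⊗ b) ⊗ (# 3 ⊕ # 4 ⊗ b) ⊗ (# 3 ⊕ # 2 ⊗ a)
    ; D  = λ a b → # 8 ⊗ (# 2 ⊕ a ⊕ b)
    ; p₀ = λ a → # 4096 ⊗ (# 1 ⊕ a) ⊛ 3
    ; p₁ = Certificate.p₁ leftCertificate
    ; p₂ = λ a → (# 2 ⊕ a) ⊛ 3
    }

  open Certificate rightCertificate

  rightTerm-diagonal : ∀ d k → rightTerm (d ℕ.+ k) k ≡ rightSupport d k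
  rightTerm-diagonal d k =
    cong₂ (λ c e → + (c₄ k ℕ.* c) * (- + 64) ^ e)
          (cong₂ _C_ (ℕₚ.+-assoc d k k) (cong (k ℕ.+_) (ℕₚ.+-identityʳ k)))
          (ℕₚ.m+n∸n≡m d k)

  rightTerm-vanish : ∀ {m k} → m ℕ.< k → rightTerm m k ≡ 0ℤ
  rightTerm-vanish {m} {k} m<k = begin
    rightTerm m k            ≡⟨ cong (λ c → + (c₄ k ℕ.* c) * s) (k>n⇒nCk≡0 m+k<2k) ⟩
    + (c₄ k ℕ.* 0) * s       ≡⟨ cong (λ c → + c * s) (ℕₚ.*-zeroʳ (c₄ k)) ⟩
    0ℤ                       ∎
    where
    open ≡-Reasoning
    s = (- + 64) ^ (m ∸ k)
    m+k<2k : m ℕ.+ k ℕ.< 2 ℕ.* k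
    m+k<2k = subst (m ℕ.+ k ℕ.<_) (cong (k ℕ.+_) (sym (ℕₚ.+-identityʳ k))) (ℕₚ.+-monoˡ-< k m<k)

  B-suc₂ᶻ : ∀ d j → + B d (suc (suc j)) * ((+ 2 + + j) * (+ 1 + + j))
                   ≡ + B (suc d) j * ((+ 1 + + d) * (+ 2 + (+ d + + j)))
  B-suc₂ᶻ d j = begin
    + B d (2 ℕ.+ j) * ((+ 2 + + j) * (+ 1 + + j))
      ≡⟨ ℤₚ.*-assoc (+ B d (2 ℕ.+ j)) (+ 2 + + j) (+ 1 + + j) ⟨
    + B d (2 ℕ.+ j) * (+ 2 + + j) * (+ 1 + + j)
      ≡⟨ cong (_* (+ 1 + + j)) (B-swapᶻ d (suc j)) ⟩
    + B (suc d) (suc j) * (+ 1 + + d) * (+ 1 + + j)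
      ≡⟨ swap (+ B (suc d) (suc j)) (+ 1 + + d) (+ 1 + + j) ⟩
    + B (suc d) (suc j) * (+ 1 + + j) * (+ 1 + + d)
      ≡⟨ cong (_* (+ 1 + + d)) (B-sucʳᶻ (suc d) j) ⟩
    + B (suc d) j * (+ 1 + (+ 1 + + d + + j)) * (+ 1 + + d)
      ≡⟨ regroup (+ B (suc d) j) (+ d) (+ j) ⟩
    + B (suc d) j * ((+ 1 + + d) * (+ 2 + (+ d + + j))) ∎
    where
    open ≡-Reasoning
    swap : ∀ a b c → a * b * c ≡ a * c * b
    swap = solve-∀
    regroup : ∀ b d j → b * (+ 1 + (+ 1 + d + j)) * (+ 1 + d) ≡ b * ((+ 1 + d) * (+ 2 + (d + j)))
    regroup = solve-∀

  c₄-sucᶻ : ∀ k → + c₄ (suc k) * ((+ 1 + + k) * (+ 1 + + k) * (+ 1 + + k) * (+ 1 + + k))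
                 ≡ + c₄ k * ((+ 1 + + 4 * + k) * (+ 2 + + 4 * + k) * (+ 3 + + 4 * + k) * (+ 4 + + 4 * + k))
  c₄-sucᶻ k = begin
    + c₄ (suc k) * (+ suc k * + suc k * + suc k * + suc k)
      ≡⟨ cong (+ c₄ (suc k) *_) (pos-*⁴ (suc k) (suc k) (suc k) (suc k)) ⟨
    + c₄ (suc k) * + (suc k ℕ.* suc k ℕ.* suc k ℕ.* suc k)
      ≡⟨ cast-* {c₄ (suc k)} {suc k ℕ.* suc k ℕ.* suc k ℕ.* suc k} {c₄ k} (c₄-suc k) ⟩
    + c₄ k * + ((1 ℕ.+ 4k) ℕ.* (2 ℕ.+ 4k) ℕ.* (3 ℕ.+ 4k) ℕ.* (4 ℕ.+ 4k))
      ≡⟨ cong (+ c₄ k *_) (pos-*⁴ (1 ℕ.+ 4k) (2 ℕ.+ 4k) (3 ℕ.+ 4k) (4 ℕ.+ 4k)) ⟩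
    + c₄ k * (+ (1 ℕ.+ 4k) * + (2 ℕ.+ 4k) * + (3 ℕ.+ 4k) * + (4 ℕ.+ 4k))
      ≡⟨ cong (λ t → + c₄ k * ((+ 1 + t) * (+ 2 + t) * (+ 3 + t) * (+ 4 + t))) (ℤₚ.pos-* 4 k) ⟩
    + c₄ k * ((+ 1 + + 4 * + k) * (+ 2 + + 4 * + k) * (+ 3 + + 4 * + k) * (+ 4 + + 4 * + k)) ∎
    where
    open ≡-Reasoning
    4k = 4 ℕ.* k
    pos-*⁴ : ∀ a b c e → + (a ℕ.* b ℕ.* c ℕ.* e) ≡ + a * + b * + c * + e
    pos-*⁴ a b c e = trans (ℤₚ.pos-* (a ℕ.* b ℕ.* c) e)
                       (cong (_* + e) (trans (ℤₚ.pos-* (a ℕ.* b) c) (cong (_* + c) (ℤₚ.pos-* a b))))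

  rightSupport-shiftₙ : ∀ d k → rightSupport d k * eval₂ X (d ℕ.+ k) k ≡ rightSupport (suc d) k * eval₂ Y (d ℕ.+ k) k
  rightSupport-shiftₙ d k = begin
    rightSupport d k * eval₂ X (d ℕ.+ k) k
      ≡⟨ cong (λ z → z * s * eval₂ X (d ℕ.+ k) k) (ℤₚ.pos-* (c₄ k) (B d j)) ⟩
    + c₄ k * + B d j * s * eval₂ X (d ℕ.+ k) k
      ≡⟨ regroup (+ c₄ k) (+ B d j) s (+ d) (+ k) ⟩
    - + 64 * s * + c₄ k * (+ B d j * (+ 1 + (+ d + + j)))
      ≡⟨ cong (λ z → - + 64 * s * + c₄ k * z) (B-sucˡᶻ d j) ⟨
    - + 64 * s * + c₄ k * (+ B (suc d) j * (+ 1 + + d))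
      ≡⟨ regroup′ (+ c₄ k) (+ B (suc d) j) s (+ d) (+ k) ⟩
    + c₄ k * + B (suc d) j * (- + 64 * s) * eval₂ Y (d ℕ.+ k) k
      ≡⟨ cong (λ z → z * (- + 64 * s) * eval₂ Y (d ℕ.+ k) k) (ℤₚ.pos-* (c₄ k) (B (suc d) j)) ⟨
    rightSupport (suc d) k * eval₂ Y (d ℕ.+ k) k ∎
    where
    open ≡-Reasoning
    j = k ℕ.+ k
    s = (- + 64) ^ d
    regroup : ∀ c b s d k → c * b * s * (- + 64 * (+ 1 + (d + k) + k)) ≡ - + 64 * s * c * (b * (+ 1 + (d + (k + k))))
    regroup = solve-∀
    regroup′ : ∀ c b s d k → - + 64 * s * c * (b * (+ 1 + d)) ≡ c * b * (- + 64 * s) * (+ 1 + (d + k) + - k)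
    regroup′ = solve-∀

  rightSupport-shiftₖ : ∀ d k → rightSupport d (suc k) * eval₂ V (suc d ℕ.+ k) k ≡ rightSupport (suc d) k * eval₂ U (suc d ℕ.+ k) k
  rightSupport-shiftₖ d k = begin
    rightSupport d (suc k) * eval₂ V (suc d ℕ.+ k) k
      ≡⟨ cong (λ i → + (c₄ (suc k) ℕ.* B d i) * s * eval₂ V (suc d ℕ.+ k) k) (cong suc (ℕₚ.+-suc k k)) ⟩
    + (c₄ (suc k) ℕ.* B d (2 ℕ.+ j)) * s * eval₂ V (suc d ℕ.+ k) k
      ≡⟨ cong (λ z → z * s * eval₂ V (suc d ℕ.+ k) k) (ℤₚ.pos-* (c₄ (suc k)) (B d (2 ℕ.+ j))) ⟩
    + c₄ (suc k) * + B d (2 ℕ.+ j) * s * eval₂ V (suc d ℕ.+ k) k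
      ≡⟨ regroup (+ c₄ (suc k)) (+ B d (2 ℕ.+ j)) s (+ k) ⟩
    - + 64 * s * (+ c₄ (suc k) * (R * R * R * R)) * (+ B d (2 ℕ.+ j) * ((+ 2 + + j) * (+ 1 + + j)))
      ≡⟨ cong₂ (λ u v → - + 64 * s * u * v) (c₄-sucᶻ k) (B-suc₂ᶻ d j) ⟩
    - + 64 * s * (+ c₄ k * (f 1 * f 2 * f 3 * f 4)) * (+ B (suc d) j * ((+ 1 + + d) * (+ 2 + (+ d + + j))))
      ≡⟨ regroup′ (+ c₄ k) (+ B (suc d) j) s (+ d) (+ k) (f 1) (f 2) (f 3) ⟩
    + c₄ k * + B (suc d) j * (- + 64 * s) * eval₂ U (suc d ℕ.+ k) k
      ≡⟨ cong (λ z → z * (- + 64 * s) * eval₂ U (suc d ℕ.+ k) k) (ℤₚ.pos-* (c₄ k) (B (suc d) j)) ⟨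
    rightSupport (suc d) k * eval₂ U (suc d ℕ.+ k) k ∎
    where
    open ≡-Reasoning
    j = k ℕ.+ k
    s = (- + 64) ^ d
    R = + 1 + + k
    f : ℕ → ℤ
    f r = + r + + 4 * + k
    regroup : ∀ c b s k →
      c * b * s * (- + 64 * ((+ 1 + k) * (+ 1 + k) * ((+ 1 + k) * (+ 1 + k))) * (+ 1 + + 2 * k) * (+ 2 + + 2 * k))
        ≡ - + 64 * s * (c * ((+ 1 + k) * (+ 1 + k) * (+ 1 + k) * (+ 1 + k))) * (b * ((+ 2 + (k + k)) * (+ 1 + (k + k))))
    regroup = solve-∀
    regroup′ : ∀ c b s d k f₁ f₂ f₃ →
      - + 64 * s * (c * (f₁ * f₂ * f₃ * (+ 4 + + 4 * k))) * (b * ((+ 1 + d) * (+ 2 + (d + (k + k)))))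
        ≡ c * b * (- + 64 * s)
          * (f₁ * f₂ * f₃ * (+ 4 * (+ 1 + k)) * (+ 1 + (+ 1 + (d + k)) + k) * (+ 1 + (d + k) + - k))
    regroup′ = solve-∀

  X≢0 : ∀ m k → eval₂ X m k ≢ 0ℤ
  X≢0 m k = *-≢0 {i = - + 64} {j = + 1 + + m + + k} (λ ()) (λ ())

  U≢0 : ∀ {n j} → j ℕ.≤ suc n → eval₂ U (2 ℕ.+ n) j ≢ 0ℤ
  U≢0 {n} {j} j≤1+n =
    *-≢0 (*-≢0 (*-≢0 (*-≢0 (*-≢0 (r+4x≢0 (+ j) ¬4∣1) (r+4x≢0 (+ j) ¬4∣2)) (r+4x≢0 (+ j) ¬4∣3))
                      (*-≢0 {i = + 4} {j = + 1 + + j} (λ ()) (λ ())))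
                (λ ()))
         (m-n≢0 (λ 2+n≡j → ℕₚ.<-irrefl (sym 2+n≡j) (s≤s j≤1+n)))

  D≢0 : ∀ {n j} → j ℕ.≤ 2 ℕ.+ n → eval₂ D n j ≢ 0ℤ
  D≢0 {n} {j} _ = *-≢0 {i = + 8} {j = + 2 + + n + + j} (λ ()) (λ ())

  Y-root : ∀ m → eval₂ Y m (suc m) ≡ 0ℤ
  Y-root m = byNormalisation (Y (Ι zero) (# 1 ⊕ Ι zero) , # 0) (λ _ → refl) (+ m ∷ [])

  U-root : ∀ m → eval₂ U m m ≡ 0ℤ
  U-root m = byNormalisation (U (Ι zero) (Ι zero) , # 0) (λ _ → refl) (+ m ∷ [])

  module Shifts = HypergeometricTerm rightTerm rightSupport (eval₂ X) (eval₂ Y) (eval₂ U) (eval₂ V)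
    rightTerm-diagonal rightTerm-vanish rightSupport-shiftₙ rightSupport-shiftₖ Y-root U-root

  module Telescoping = CreativeTelescoping rightTerm (eval₂ X) (eval₂ Y) (eval₂ U) (eval₂ V) (eval₂ N) (eval₂ D)
    (eval₁ p₀) (eval₁ p₁) (eval₁ p₂)
    rightTerm-vanish Shifts.F-shiftₙ Shifts.F-shiftₖ X≢0 U≢0 D≢0
    (λ n → byNormalisation (baseIdentity rightCertificate) (λ _ → refl) (+ n ∷ []))
    (λ n j → byNormalisation (stepIdentity rightCertificate) (λ _ → refl) (+ n ∷ + j ∷ []))
    (λ n → byNormalisation (endIdentity rightCertificate) (λ _ → refl) (+ n ∷ []))

  rightTerm-symmetric : ∀ n {k} → k ℕ.≤ n → + (c₄ k ℕ.* ((n ℕ.+ k) C (n ∸ k))) * (-[1+ 63 ] ^ (n ∸ k)) ≡ rightTerm n k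
  rightTerm-symmetric n {k} k≤n = cong (λ c → + (c₄ k ℕ.* c) * (-[1+ 63 ] ^ (n ∸ k))) (begin
    (n ℕ.+ k) C (n ∸ k)              ≡⟨ cong ((n ℕ.+ k) C_) n+k∸2k≡n∸k ⟨
    (n ℕ.+ k) C (n ℕ.+ k ∸ 2 ℕ.* k)  ≡⟨ nCk≡nC[n∸k] 2k≤n+k ⟨
    (n ℕ.+ k) C (2 ℕ.* k)            ∎)
    where
    open ≡-Reasoning
    2k≡k+k : 2 ℕ.* k ≡ k ℕ.+ k
    2k≡k+k = cong (k ℕ.+_) (ℕₚ.+-identityʳ k)
    2k≤n+k : 2 ℕ.* k ℕ.≤ n ℕ.+ k
    2k≤n+k = subst (ℕ._≤ n ℕ.+ k) (sym 2k≡k+k) (ℕₚ.+-monoˡ-≤ k k≤n)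
    n+k∸2k≡n∸k : n ℕ.+ k ∸ 2 ℕ.* k ≡ n ∸ k
    n+k∸2k≡n∸k = begin
      n ℕ.+ k ∸ 2 ℕ.* k      ≡⟨ cong (n ℕ.+ k ∸_) 2k≡k+k ⟩
      n ℕ.+ k ∸ (k ℕ.+ k)    ≡⟨ ℕₚ.∸-+-assoc (n ℕ.+ k) k k ⟨
      n ℕ.+ k ∸ k ∸ k        ≡⟨ cong (_∸ k) (ℕₚ.m+n∸n≡m n k) ⟩
      n ∸ k                  ∎

  rightSum : ℕ → ℤ
  rightSum n = sumToℤ n (rightTerm n)

  rightSum-recurrence : ∀ n →
    eval₁ p₀ n * rightSum n + eval₁ p₁ n * rightSum (1 ℕ.+ n) + eval₁ p₂ n * rightSum (2 ℕ.+ n) ≡ 0ℤ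
  rightSum-recurrence = Telescoping.recurrence

module SumComparison where

  open import Data.Nat as ℕ using (ℕ; zero; suc; _!)
  open import Data.Fin using (zero; suc)
  open import Data.Vec using ([]; _∷_)
  open import Data.Product using (_,_)
  open import Data.Integer using (ℤ; +_; _+_; _*_; 0ℤ)
  import Data.Integer.Properties as ℤₚ
  open import Relation.Binary.PropositionalEquality
  open IntegerSequences using (module ThreeTermRecurrence)
  open PolynomialCertificates
  open LeftSum using (leftCertificate; leftSum; leftSum-recurrence)
  open RightSum using (rightCertificate; rightSum; rightSum-recurrence)

  module L = Certificate leftCertificate
  module R = Certificate rightCertificate

  p₂≢0 : ∀ n → eval₁ L.p₂ n ≢ 0ℤ
  p₂≢0 n ()

  open ThreeTermRecurrence (eval₁ L.p₀) (eval₁ L.p₁) (eval₁ L.p₂) p₂≢0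

  x f : Expr ℤ 2
  x = Ι zero
  f = Ι (suc zero)

  +[1+n]!≡ : ∀ n → + (suc n !) ≡ (+ 1 + + n) * + (n !)
  +[1+n]!≡ n = ℤₚ.pos-* (suc n) (n !)

  coeff₀ : ∀ n → eval₁ L.p₀ n * (+ (n !) * + (n !)) ≡ + (suc n !) * + (suc n !) * eval₁ R.p₀ n
  coeff₀ n = begin
    eval₁ L.p₀ n * (+ (n !) * + (n !))
      ≡⟨ byNormalisation (L.p₀ x ⊗ f ² , ((# 1 ⊕ x) ⊗ f) ² ⊗ R.p₀ x) (λ _ → refl) (+ n ∷ + (n !) ∷ []) ⟩
    (+ 1 + + n) * + (n !) * ((+ 1 + + n) * + (n !)) * eval₁ R.p₀ n
      ≡⟨ cong (λ u → u * u * eval₁ R.p₀ n) (+[1+n]!≡ n) ⟨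
    + (suc n !) * + (suc n !) * eval₁ R.p₀ n ∎
    where open ≡-Reasoning

  coeff₂ : ∀ n → eval₁ L.p₂ n * (+ ((2 ℕ.+ n) !) * + ((2 ℕ.+ n) !)) ≡ + (suc n !) * + (suc n !) * eval₁ R.p₂ n
  coeff₂ n = begin
    eval₁ L.p₂ n * (+ ((2 ℕ.+ n) !) * + ((2 ℕ.+ n) !))
      ≡⟨ cong (λ u → eval₁ L.p₂ n * (u * u)) (trans (+[1+n]!≡ (suc n)) (cong (+ (2 ℕ.+ n) *_) (+[1+n]!≡ n))) ⟩
    eval₁ L.p₂ n * ((+ 2 + + n) * ((+ 1 + + n) * + (n !)) * ((+ 2 + + n) * ((+ 1 + + n) * + (n !))))
      ≡⟨ byNormalisation (L.p₂ x ⊗ ((# 2 ⊕ x) ⊗ ((# 1 ⊕ x) ⊗ f)) ² , ((# 1 ⊕ x) ⊗ f) ² ⊗ R.p₂ x)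
                         (λ _ → refl) (+ n ∷ + (n !) ∷ []) ⟩
    (+ 1 + + n) * + (n !) * ((+ 1 + + n) * + (n !)) * eval₁ R.p₂ n
      ≡⟨ cong (λ u → u * u * eval₁ R.p₂ n) (+[1+n]!≡ n) ⟨
    + (suc n !) * + (suc n !) * eval₁ R.p₂ n ∎
    where open ≡-Reasoning

  leftSum≡[n!]²*rightSum : ∀ n → leftSum n ≡ + (n !) * + (n !) * rightSum n
  leftSum≡[n!]²*rightSum =
    recurrence-unique leftSum-recurrence
      (scaled-satisfies (λ n → + (n !)) (eval₁ R.p₀) (eval₁ R.p₂) rightSum-recurrence coeff₀ coeff₂)
      refl refl

module RationalForm where

  open import Data.Nat as ℕ using (ℕ; zero; suc; _∸_; _!; z≤n)
  import Data.Nat.Properties as ℕₚ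
  open import Data.Nat.Coprimality using (1-coprimeTo) renaming (sym to coprime-sym)
  open import Data.Nat.Combinatorics using (_C_)
  open import Data.Integer as ℤ using (ℤ; +_; -_; -[1+_])
  import Data.Integer.Properties as ℤₚ
  import Data.Integer.Tactic.RingSolver as ℤ-Solver
  open import Data.Rational as ℚ using (ℚ; mkℚ; _+_; _*_; _/_; 0ℚ; 1ℚ; 1/_; ↥_)
  import Data.Rational.Properties as ℚₚ
  open import Data.Maybe using (nothing)
  open import Relation.Nullary using (yes; no)
  open import Relation.Nullary.Negation using (contradiction)
  open import Relation.Binary.PropositionalEquality
  import Tactic.RingSolver.Core.AlmostCommutativeRing as ACR
  open import Tactic.RingSolver using (solve-∀)
  open import Defs
  open IntegerSequences using (*-≢0)
  open Binomials using (C-factorial)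
  open LeftSum using (poch₄; leftTerm)

  ℚ-ring : ACR.AlmostCommutativeRing _ _
  ℚ-ring = ACR.fromCommutativeRing ℚₚ.+-*-commutativeRing (λ _ → nothing)

  ι : ℤ → ℚ
  ι i = i / 1

  ι-mkℚ : ∀ i → ι i ≡ mkℚ i 0 (coprime-sym (1-coprimeTo ℤ.∣ i ∣))
  ι-mkℚ (+ n)    = ℚₚ.normalize-coprime (coprime-sym (1-coprimeTo n))
  ι-mkℚ -[1+ n ] = cong ℚ.-_ (ℚₚ.normalize-coprime (coprime-sym (1-coprimeTo (suc n))))

  ι-+ : ∀ i j → ι (i ℤ.+ j) ≡ ι i + ι j
  ι-+ i j rewrite ι-mkℚ i | ι-mkℚ j = cong (_/ 1) (sym (cong₂ ℤ._+_ (ℤₚ.*-identityʳ i) (ℤₚ.*-identityʳ j)))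

  ι-* : ∀ i j → ι (i ℤ.* j) ≡ ι i * ι j
  ι-* i j rewrite ι-mkℚ i | ι-mkℚ j = refl

  ι-≢0 : ∀ {i} → i ≢ ℤ.0ℤ → ι i ≢ 0ℚ
  ι-≢0 {i} i≢0 ιi≡0 = i≢0 (cong ↥_ (trans (sym (ι-mkℚ i)) ιi≡0))

  ℚ-*-cancelʳ : ∀ {p q} r → r ≢ 0ℚ → p * r ≡ q * r → p ≡ q
  ℚ-*-cancelʳ {p} {q} r r≢0 pr≡qr = begin
    p                ≡⟨ ℚₚ.*-identityʳ p ⟨
    p * 1ℚ           ≡⟨ cong (p *_) (ℚₚ.*-inverseʳ r) ⟨
    p * (r * 1/ r)   ≡⟨ ℚₚ.*-assoc p r (1/ r) ⟨
    p * r * 1/ r     ≡⟨ cong (_* 1/ r) pr≡qr ⟩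
    q * r * 1/ r     ≡⟨ ℚₚ.*-assoc q r (1/ r) ⟩
    q * (r * 1/ r)   ≡⟨ cong (q *_) (ℚₚ.*-inverseʳ r) ⟩
    q * 1ℚ           ≡⟨ ℚₚ.*-identityʳ q ⟩
    q                ∎
    where
    open ≡-Reasoning
    instance _ = ℚ.≢-nonZero r≢0

  /'-*-cancel : ∀ p {q} → q ≢ 0ℚ → (p /' q) * q ≡ p
  /'-*-cancel p {q} q≢0 with q ℚₚ.≟ 0ℚ
  ... | yes q≡0 = contradiction q≡0 q≢0
  ... | no q≢0′ = trans (ℚₚ.*-assoc p _ q) (trans (cong (p *_) (ℚₚ.*-inverseˡ q {{ℚ.≢-nonZero q≢0′}})) (ℚₚ.*-identityʳ p))

  sumTo-cong : ∀ n {f g : ℕ → ℚ} → (∀ {k} → k ℕ.≤ n → f k ≡ g k) → sumTo n f ≡ sumTo n g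
  sumTo-cong zero    f≗g = f≗g z≤n
  sumTo-cong (suc n) f≗g = cong₂ _+_ (sumTo-cong n (λ k≤n → f≗g (ℕₚ.m≤n⇒m≤1+n k≤n))) (f≗g ℕₚ.≤-refl)

  sumTo-*ʳ : ∀ n f c → sumTo n f * c ≡ sumTo n (λ k → f k * c)
  sumTo-*ʳ zero    f c = refl
  sumTo-*ʳ (suc n) f c = trans (ℚₚ.*-distribʳ-+ c (sumTo n f) (f (suc n))) (cong (_+ f (suc n) * c) (sumTo-*ʳ n f c))

  sumTo-*ˡ : ∀ n c f → c * sumTo n f ≡ sumTo n (λ k → c * f k)
  sumTo-*ˡ zero    c f = refl
  sumTo-*ˡ (suc n) c f = trans (ℚₚ.*-distribˡ-+ c (sumTo n f) (f (suc n))) (cong (_+ c * f (suc n)) (sumTo-*ˡ n c f))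

  ι-sumToℤ : ∀ n f → ι (sumToℤ n f) ≡ sumTo n (λ k → ι (f k))
  ι-sumToℤ zero    f = refl
  ι-sumToℤ (suc n) f = trans (ι-+ (sumToℤ n f) (f (suc n))) (cong (_+ ι (f (suc n))) (ι-sumToℤ n f))

  poch-one : ∀ k → poch 1ℚ k ≡ ι (+ (k !))
  poch-one zero    = refl
  poch-one (suc k) = begin
    poch 1ℚ k * (1ℚ + ι (+ k))   ≡⟨ cong₂ _*_ (poch-one k) (sym (ι-+ (+ 1) (+ k))) ⟩
    ι (+ (k !)) * ι (+ suc k)    ≡⟨ ι-* (+ (k !)) (+ suc k) ⟨
    ι (+ (k !) ℤ.* + suc k)      ≡⟨ cong ι (ℤₚ.pos-* (k !) (suc k)) ⟨
    ι (+ (k ! ℕ.* suc k))        ≡⟨ cong (λ i → ι (+ i)) (ℕₚ.*-comm (k !) (suc k)) ⟩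
    ι (+ (suc k !))              ∎
    where open ≡-Reasoning

  poch-quarter : ∀ r → (+ r / 4) * ι (+ 4) ≡ ι (+ r) → ∀ k → poch (+ r / 4) k * ι ((+ 4) ℤ.^ k) ≡ ι (poch₄ r k)
  poch-quarter r r/4*4≡r zero    = ℚₚ.*-identityˡ (ι (+ 1))
  poch-quarter r r/4*4≡r (suc k) = begin
    poch a k * (a + ι (+ k)) * ι (+ 4 ℤ.* (+ 4) ℤ.^ k)
      ≡⟨ cong (poch a k * (a + ι (+ k)) *_) (ι-* (+ 4) ((+ 4) ℤ.^ k)) ⟩
    poch a k * (a + ι (+ k)) * (ι (+ 4) * ι ((+ 4) ℤ.^ k))
      ≡⟨ regroup (poch a k) a (ι (+ k)) (ι (+ 4)) (ι ((+ 4) ℤ.^ k)) ⟩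
    poch a k * ι ((+ 4) ℤ.^ k) * (a * ι (+ 4) + ι (+ 4) * ι (+ k))
      ≡⟨ cong₂ (λ u v → u * (v + ι (+ 4) * ι (+ k))) (poch-quarter r r/4*4≡r k) r/4*4≡r ⟩
    ι (poch₄ r k) * (ι (+ r) + ι (+ 4) * ι (+ k))
      ≡⟨ cong (λ u → ι (poch₄ r k) * (ι (+ r) + u)) (ι-* (+ 4) (+ k)) ⟨
    ι (poch₄ r k) * (ι (+ r) + ι (+ 4 ℤ.* + k))
      ≡⟨ cong (ι (poch₄ r k) *_) (ι-+ (+ r) (+ 4 ℤ.* + k)) ⟨
    ι (poch₄ r k) * ι (+ r ℤ.+ + 4 ℤ.* + k)
      ≡⟨ ι-* (poch₄ r k) (+ r ℤ.+ + 4 ℤ.* + k) ⟨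
    ι (poch₄ r (suc k)) ∎
    where
    open ≡-Reasoning
    a = + r / 4
    regroup : ∀ P a t f e → P * (a + t) * (f * e) ≡ P * e * (a * f + f * t)
    regroup = solve-∀ ℚ-ring

  +n!≢0 : ∀ n → + (n !) ≢ ℤ.0ℤ
  +n!≢0 n n!≡0 = ℕ.≢-nonZero⁻¹ (n !) {{ℕₚ._!≢0 n}} (ℤₚ.+-injective n!≡0)

  [-64]^n-split : ∀ n → (- + 64) ℤ.^ n ≡ (- + 4) ℤ.^ n ℤ.* ((+ 4) ℤ.^ n ℤ.* (+ 4) ℤ.^ n)
  [-64]^n-split zero    = refl
  [-64]^n-split (suc n) = trans (cong (- + 64 ℤ.*_) ([-64]^n-split n)) (regroup ((- + 4) ℤ.^ n) ((+ 4) ℤ.^ n))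
    where
    regroup : ∀ a b → - + 64 ℤ.* (a ℤ.* (b ℤ.* b)) ≡ - + 4 ℤ.* a ℤ.* (+ 4 ℤ.* b ℤ.* (+ 4 ℤ.* b))
    regroup = ℤ-Solver.solve-∀

  ι-[-64]^n : ∀ {n k} → k ℕ.≤ n →
    ι (-[1+ 63 ] ℤ.^ n)
      ≡ ι ((- + 4) ℤ.^ n) * (ι ((+ 4) ℤ.^ k) * ι ((+ 4) ℤ.^ (n ∸ k)) * (ι ((+ 4) ℤ.^ k) * ι ((+ 4) ℤ.^ (n ∸ k))))
  ι-[-64]^n {n} {k} k≤n = begin
    ι (-[1+ 63 ] ℤ.^ n)
      ≡⟨ cong ι ([-64]^n-split n) ⟩
    ι ((- + 4) ℤ.^ n ℤ.* ((+ 4) ℤ.^ n ℤ.* (+ 4) ℤ.^ n))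
      ≡⟨ cong (λ u → ι ((- + 4) ℤ.^ n ℤ.* (u ℤ.* u))) 4^n≡4^k*4^j ⟩
    ι ((- + 4) ℤ.^ n ℤ.* (4^k*4^j ℤ.* 4^k*4^j))
      ≡⟨ trans (ι-* ((- + 4) ℤ.^ n) (4^k*4^j ℤ.* 4^k*4^j))
               (cong (ι ((- + 4) ℤ.^ n) *_) (trans (ι-* 4^k*4^j 4^k*4^j) (cong₂ _*_ split split))) ⟩
    ι ((- + 4) ℤ.^ n) * (ι ((+ 4) ℤ.^ k) * ι ((+ 4) ℤ.^ (n ∸ k)) * (ι ((+ 4) ℤ.^ k) * ι ((+ 4) ℤ.^ (n ∸ k)))) ∎
    where
    open ≡-Reasoning
    4^k*4^j = (+ 4) ℤ.^ k ℤ.* (+ 4) ℤ.^ (n ∸ k)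
    4^n≡4^k*4^j : (+ 4) ℤ.^ n ≡ 4^k*4^j
    4^n≡4^k*4^j = trans (cong ((+ 4) ℤ.^_) (sym (ℕₚ.m+[n∸m]≡n k≤n))) (ℤₚ.^-distribˡ-+-* (+ 4) k (n ∸ k))
    split = ι-* ((+ 4) ℤ.^ k) ((+ 4) ℤ.^ (n ∸ k))

  ι-[n!]² : ∀ {n k} → k ℕ.≤ n →
    ι (+ (n !) ℤ.* + (n !))
      ≡ ι (+ (n C k)) * (ι (+ (k !)) * ι (+ ((n ∸ k) !))) * (ι (+ (n C k)) * (ι (+ (k !)) * ι (+ ((n ∸ k) !))))
  ι-[n!]² {n} {k} k≤n = trans (ι-* (+ (n !)) (+ (n !))) (cong (λ u → u * u) (begin
    ι (+ (n !))                                         ≡⟨ cong ι (cong +_ (C-factorial k≤n)) ⟨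
    ι (+ ((n C k) ℕ.* (k ! ℕ.* (n ∸ k) !)))             ≡⟨ cong ι (ℤₚ.pos-* (n C k) (k ! ℕ.* (n ∸ k) !)) ⟩
    ι (+ (n C k) ℤ.* + (k ! ℕ.* (n ∸ k) !))             ≡⟨ ι-* (+ (n C k)) (+ (k ! ℕ.* (n ∸ k) !)) ⟩
    ι (+ (n C k)) * ι (+ (k ! ℕ.* (n ∸ k) !))           ≡⟨ cong (λ u → ι (+ (n C k)) * ι u) (ℤₚ.pos-* (k !) ((n ∸ k) !)) ⟩
    ι (+ (n C k)) * ι (+ (k !) ℤ.* + ((n ∸ k) !))       ≡⟨ cong (ι (+ (n C k)) *_) (ι-* (+ (k !)) (+ ((n ∸ k) !))) ⟩
    ι (+ (n C k)) * (ι (+ (k !)) * ι (+ ((n ∸ k) !)))   ∎))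
    where open ≡-Reasoning

  quarterTerm : ℕ → ℕ → ℚ
  quarterTerm n k = (poch (+ 1 / 4) k * poch (+ 3 / 4) (n ∸ k)) /' (poch 1ℚ k * poch 1ℚ (n ∸ k))

  quarterTerm-cleared : ∀ n k → quarterTerm n k * (ι (+ (k !)) * ι (+ ((n ∸ k) !))) ≡ poch (+ 1 / 4) k * poch (+ 3 / 4) (n ∸ k)
  quarterTerm-cleared n k =
    trans (cong (quarterTerm n k *_) (sym denominator≡)) (/'-*-cancel (poch (+ 1 / 4) k * poch (+ 3 / 4) (n ∸ k)) denominator≢0)
    where
    denominator≡ : poch 1ℚ k * poch 1ℚ (n ∸ k) ≡ ι (+ (k !)) * ι (+ ((n ∸ k) !))
    denominator≡ = cong₂ _*_ (poch-one k) (poch-one (n ∸ k))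
    denominator≢0 : poch 1ℚ k * poch 1ℚ (n ∸ k) ≢ 0ℚ
    denominator≢0 = subst (_≢ 0ℚ) (trans (ι-* (+ (k !)) (+ ((n ∸ k) !))) (sym denominator≡))
                          (ι-≢0 (*-≢0 (+n!≢0 k) (+n!≢0 (n ∸ k))))

  quarterTerm-scaled : ∀ n {k} → k ℕ.≤ n →
    ι (-[1+ 63 ] ℤ.^ n) * (quarterTerm n k * quarterTerm n k) * ι (+ (n !) ℤ.* + (n !)) ≡ ι (leftTerm n k)
  quarterTerm-scaled n {k} k≤n = begin
    ι (-[1+ 63 ] ℤ.^ n) * (T * T) * ι (+ (n !) ℤ.* + (n !))
      ≡⟨ cong₂ (λ u v → u * (T * T) * v) (ι-[-64]^n k≤n) (ι-[n!]² k≤n) ⟩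
    m * (e * e′ * (e * e′)) * (T * T) * (c * (x * y) * (c * (x * y)))
      ≡⟨ regroup m e e′ T c (x * y) ⟩
    m * (c * (T * (x * y)) * e * e′ * (c * (T * (x * y)) * e * e′))
      ≡⟨ cong (λ u → m * (c * u * e * e′ * (c * u * e * e′))) (quarterTerm-cleared n k) ⟩
    m * (c * (P₁ * P₃) * e * e′ * (c * (P₁ * P₃) * e * e′))
      ≡⟨ regroup′ m c P₁ P₃ e e′ ⟩
    m * (c * (P₁ * e) * (P₃ * e′) * (c * (P₁ * e) * (P₃ * e′)))
      ≡⟨ cong₂ (λ u v → m * (c * u * v * (c * u * v))) (poch-quarter 1 refl k) (poch-quarter 3 refl j) ⟩
    m * (c * ι (poch₄ 1 k) * ι (poch₄ 3 j) * (c * ι (poch₄ 1 k) * ι (poch₄ 3 j)))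
      ≡⟨ cong (λ u → m * (u * u)) (sym (trans (ι-* (+ (n C k) ℤ.* poch₄ 1 k) (poch₄ 3 j))
                                              (cong (_* ι (poch₄ 3 j)) (ι-* (+ (n C k)) (poch₄ 1 k))))) ⟩
    m * (ι w * ι w)
      ≡⟨ trans (ι-* ((- + 4) ℤ.^ n) (w ℤ.* w)) (cong (m *_) (ι-* w w)) ⟨
    ι (leftTerm n k) ∎
    where
    open ≡-Reasoning
    j = n ∸ k
    T = quarterTerm n k
    P₁ = poch (+ 1 / 4) k
    P₃ = poch (+ 3 / 4) j
    m = ι ((- + 4) ℤ.^ n)
    e = ι ((+ 4) ℤ.^ k)
    e′ = ι ((+ 4) ℤ.^ j)
    c = ι (+ (n C k))
    x = ι (+ (k !))
    y = ι (+ (j !))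
    w = + (n C k) ℤ.* poch₄ 1 k ℤ.* poch₄ 3 j
    regroup : ∀ m e e′ T c d → m * (e * e′ * (e * e′)) * (T * T) * (c * d * (c * d))
                              ≡ m * (c * (T * d) * e * e′ * (c * (T * d) * e * e′))
    regroup = solve-∀ ℚ-ring
    regroup′ : ∀ m c p q e e′ → m * (c * (p * q) * e * e′ * (c * (p * q) * e * e′))
                               ≡ m * (c * (p * e) * (q * e′) * (c * (p * e) * (q * e′)))
    regroup′ = solve-∀ ℚ-ring

open import Defs
open import Data.Nat as ℕ using (ℕ; _∸_)
open import Data.Nat.Combinatorics using (_C_)
open import Data.Integer as ℤ using (ℤ; +_; -[1+_])
open import Data.Rational using (ℚ; _*_; _/_; 1ℚ)
open import Relation.Binary.PropositionalEquality using (_≡_)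
open import Data.Nat using (_!)
import Data.Rational.Properties as ℚₚ
open import Relation.Binary.PropositionalEquality using (cong; trans; module ≡-Reasoning)
open IntegerSequences using (*-≢0; sumToℤ-cong)
open Binomials using (c₄)
open LeftSum using (leftTerm; leftSum)
open RightSum using (rightSum; rightTerm-symmetric)
open SumComparison using (leftSum≡[n!]²*rightSum)
open RationalForm

mainTheorem6 : (n : ℕ) →
    ((-[1+ 63 ] ℤ.^ n) / 1)
      * sumTo n (λ k →
          ((poch ((+ 1) / 4) k * poch ((+ 3) / 4) (n ∸ k))
            /' (poch 1ℚ k * poch 1ℚ (n ∸ k)))
          * ((poch ((+ 1) / 4) k * poch ((+ 3) / 4) (n ∸ k))
            /' (poch 1ℚ k * poch 1ℚ (n ∸ k))))
    ≡ (sumToℤ n (λ k →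
        (+ (((4 ℕ.* k) C (2 ℕ.* k)) ℕ.* ((2 ℕ.* k) C k) ℕ.* ((2 ℕ.* k) C k)
            ℕ.* ((n ℕ.+ k) C (n ∸ k))))
        ℤ.* (-[1+ 63 ] ℤ.^ (n ∸ k)))) / 1
mainTheorem6 n = ℚ-*-cancelʳ (ι [n!]²) (ι-≢0 (*-≢0 (+n!≢0 n) (+n!≢0 n))) (begin
  ι (-[1+ 63 ] ℤ.^ n) * sumTo n (λ k → quarterTerm n k * quarterTerm n k) * ι [n!]²
    ≡⟨ cong (_* ι [n!]²) (sumTo-*ˡ n (ι (-[1+ 63 ] ℤ.^ n)) (λ k → quarterTerm n k * quarterTerm n k)) ⟩
  sumTo n (λ k → ι (-[1+ 63 ] ℤ.^ n) * (quarterTerm n k * quarterTerm n k)) * ι [n!]²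
    ≡⟨ sumTo-*ʳ n (λ k → ι (-[1+ 63 ] ℤ.^ n) * (quarterTerm n k * quarterTerm n k)) (ι [n!]²) ⟩
  sumTo n (λ k → ι (-[1+ 63 ] ℤ.^ n) * (quarterTerm n k * quarterTerm n k) * ι [n!]²)
    ≡⟨ sumTo-cong n (quarterTerm-scaled n) ⟩
  sumTo n (λ k → ι (leftTerm n k))
    ≡⟨ ι-sumToℤ n (leftTerm n) ⟨
  ι (leftSum n)
    ≡⟨ cong ι (leftSum≡[n!]²*rightSum n) ⟩
  ι ([n!]² ℤ.* rightSum n)
    ≡⟨ trans (ι-* [n!]² (rightSum n)) (ℚₚ.*-comm (ι [n!]²) (ι (rightSum n))) ⟩
  ι (rightSum n) * ι [n!]²
    ≡⟨ cong (λ s → ι s * ι [n!]²) (sumToℤ-cong n (rightTerm-symmetric n)) ⟨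
  ι (sumToℤ n (λ k → + (c₄ k ℕ.* ((n ℕ.+ k) C (n ∸ k))) ℤ.* (-[1+ 63 ] ℤ.^ (n ∸ k)))) * ι [n!]² ∎)
  where
  open ≡-Reasoning
  [n!]² = + (n !) ℤ.* + (n !)
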